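{- Let $\Gamma$ be a finite tight program (rules may contain aggregate expressions in their bodies). An interpretation $\mathcal I$ is a stable model of $\Gamma$ if and only if $\mathcal I$ is contained in the vocabulary of $\Gamma$ and $\mathcal I$ satisfies the completion of $\Gamma$.
   Context: Syntax. Fix pairwise disjoint sets of numerals, symbolic constants, variables, operation names (each with an arity) and aggregate names, not containing the special symbols $\mathit{inf}$, $\mathit{sup}$, $\mathit{not}$, $..$, the relation symbols $=,\neq,<,>,\le,\ge$, or logical symbols. There is a fixed bijection $n\mapsto\overline n$ from $\mathbb Z$ onto the numerals. Each $n$-ary operation name $\mathit{op}$ has a function $\widehat{\mathit{op}}$ from a subset of $\mathbb Z^n$ to $\mathbb Z$; each aggregate name $\alpha$ has a function $\widehat\alpha$ mapping every set of non-empty tuples of precomputed terms to a precomputed term. Terms: numerals, symbolic constants, variables, $\mathit{inf}$, $\mathit{sup}$; $f(\mathbf t)$ for a symbolic constant $f$ and a non-empty tuple of terms $\mathbf t$; $\mathit{op}(\mathbf t)$ for an $n$-ary operation name and an $n$-tuple of terms; $(t_1..t_2)$ for terms $t_1,t_2$. A term is ground if it has no variables, precomputed if it is ground and contains neither operation names nor $..$. A fixed total order on precomputed terms has $\mathit{inf}$ least, $\mathit{sup}$ greatest, and $\overline m\le\overline n$ iff $m\le n$; relation symbols are interpreted on precomputed terms via this order ($=$ is identity). The set $[t]$ of values of a ground term: $[t]=\{t\}$ for a numeral, symbolic constant, $\mathit{inf}$, $\mathit{sup}$; $[f(t_1,\dots,t_n)]=\{f(r_1,\dots,r_n): r_i\in[t_i]\}$;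 $[\mathit{op}(t_1,\dots,t_n)]$ is the set of numerals $\overline{\widehat{\mathit{op}}(k_1,\dots,k_n)}$ for $(k_1,\dots,k_n)$ in the domain of $\widehat{\mathit{op}}$ with $\overline{k_i}\in[t_i]$; $[(t_1..t_2)]$ is the set of numerals $\overline m$ such that $k_1\le m\le k_2$ for some $\overline{k_1}\in[t_1],\overline{k_2}\in[t_2]$. For tuples, $[t_1,\dots,t_n]$ is the set of tuples $r_1,\dots,r_n$ with $r_i\in[t_i]$. An atom is $p(\mathbf t)$ with $p$ a symbolic constant and $\mathbf t$ a possibly empty tuple of terms; a literal is an atom (positive) or $\mathit{not}\ A$ for an atom $A$ (negative); a comparison is $(t_1\prec t_2)$ with $\prec$ a relation symbol; an aggregate expression is $\alpha\{\mathbf t:\mathbf C\}\prec s$ with $\mathbf t$ a non-empty tuple of terms, $\mathbf C$ a conjunction of literals and comparisons, and $s$ a variable or precomputed term. A rule is $\mathit{Head}\leftarrow\mathit{Body}$ where $\mathit{Body}$ is a (possibly empty) conjunction of literals, comparisons and aggregate expressions, and $\mathit{Head}$ is an atom (basic rule), an expression $\{A\}$ with $A$ an atom (choice rule), or empty (constraint). A program is a set of rules. A variable of a rule is local if every occurrence of it lies in the left-hand part $\alpha\{\mathbf t:\mathbf C\}$ of an aggregate expression in the body, and global otherwise. A predicate symbol is a pair $p/n$; it occurs in an expression if the expression contains an atom $p(t_1,\dots,t_n)$. The vocabulary of a program is the set of atoms $p(\mathbf r)$ with $\mathbf r$ an $n$-tuple of precomputed terms and $p/n$ occurring in it. An interpretation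 is a set of atoms $p(\mathbf r)$ with $\mathbf r$ a tuple of precomputed terms. Tightness. $G_\Gamma$ is the directed graph whose vertices are the predicate symbols occurring in $\Gamma$, with an edge from $q/m$ to $p/n$ if some rule $R$ of $\Gamma$ has $q/m$ occurring in its head and $p/n$ occurring in a positive literal or in an aggregate expression in its body. $\Gamma$ is tight if $G_\Gamma$ is acyclic. Formulas and arguments (mutually recursive): (a) $p(\mathbf{arg})$ for a symbolic constant $p$ and tuple of arguments; (b) $(\mathit{arg}_1\prec\mathit{arg}_2)$; (c) $\mathit{arg}\in t$ for an argument and a term $t$; (d) $\bot$; (e) $F\to G$; (f) $\forall X F$ are formulas; (g) numerals, symbolic constants, variables, $\mathit{inf}$, $\mathit{sup}$; (h) $f(\mathbf{arg})$ for a symbolic constant $f$ and non-empty tuple of arguments; (i) $\alpha\{\mathbf X\mid F\}$ for an aggregate name, non-empty tuple $\mathbf X$ of distinct variables, and formula $F$, are arguments. Other connectives and $\exists$ are the usual abbreviations. Occurrences of $X$ are bound if inside $\forall XF$ or inside $\alpha\{\mathbf X\mid F\}$ with $X$ in $\mathbf X$. For an interpretation $\mathcal I$, closed formulas get truth values and closed arguments get precomputed terms: $p(\mathit{arg}_1,..,\mathit{arg}_k)$ is true iff $p(\mathit{arg}_1^{\mathcal I},\dots,\mathit{arg}_k^{\mathcal I})\in\mathcal I$; $\mathit{arg}_1\prec\mathit{arg}_2$ is true iff $\mathit{arg}_1^{\mathcal I}\prec\mathit{arg}_2^{\mathcal I}$; $\mathit{arg}\in t$ is true iff $\mathit{arg}^{\mathcal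 I}\in[t]$; $\bot$ false; $\to$ classical; $\forall XF$ true iff $F^X_r$ is true for every precomputed term $r$; numerals, symbolic constants, $\mathit{inf},\mathit{sup}$ denote themselves; $f(\dots)^{\mathcal I}=f(\mathit{arg}_1^{\mathcal I},\dots)$; $\alpha\{X_1,\dots,X_k\mid F\}^{\mathcal I}=\widehat\alpha(T)$ where $T$ is the set of tuples $r_1,\dots,r_k$ of precomputed terms with $F^{X_1\dots X_k}_{r_1\dots r_k}$ true. Formula representation. $\phi\,p(\mathbf t)=\exists\mathbf X(\mathbf X\in\mathbf t\wedge p(\mathbf X))$; $\phi(\mathit{not}\ p(\mathbf t))=\exists\mathbf X(\mathbf X\in\mathbf t\wedge\neg p(\mathbf X))$; $\phi(t_1\prec t_2)=\exists X_1X_2(X_1\in t_1\wedge X_2\in t_2\wedge X_1\prec X_2)$, with new variables ($\mathbf X\in\mathbf t$ is the conjunction of the componentwise memberships). For a list $\mathbf X$ of distinct variables, $\phi^{\mathbf X}$ equals $\phi$ on literals and comparisons, and maps the aggregate expression $\alpha\{\mathbf t:\mathbf C\}\prec s$ to $\exists Y(\alpha\{\mathbf Z\mid\exists\mathbf X(\mathbf Z\in\mathbf t\wedge\phi\mathbf C)\}\prec Y\wedge Y\in s)$ with new $\mathbf Z,Y$; on conjunctions it acts conjunct-wise. With $\mathbf X$ the local variables of the rule and $\mathbf V$ new variables: a basic rule $p(\mathbf t)\leftarrow\mathit{Body}$ is represented by $\mathbf V\in\mathbf t\wedge\phi^{\mathbf X}(\mathit{Body})\to p(\mathbf V)$; a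 choice rule $\{p(\mathbf t)\}\leftarrow\mathit{Body}$ by $\mathbf V\in\mathbf t\wedge\phi^{\mathbf X}(\mathit{Body})\wedge p(\mathbf V)\to p(\mathbf V)$; a constraint $\leftarrow\mathit{Body}$ by $\neg\phi^{\mathbf X}(\mathit{Body})$. Completion. The definition of $p/n$ in $\Gamma$ consists of the basic rules of $\Gamma$ with head $p(t_1,\dots,t_n)$ and the choice rules with head $\{p(t_1,\dots,t_n)\}$. If it is $\{R_1,\dots,R_k\}$, write the representation of $R_i$ as $F_i\to p(\mathbf V)$ with the same tuple $\mathbf V$ of distinct variables for all $i$; the completed definition of $p/n$ is $\forall\mathbf V(p(\mathbf V)\leftrightarrow\bigvee_{i=1}^k\exists\mathbf U_iF_i)$, where $\mathbf U_i$ lists the free variables of $F_i$ not in $\mathbf V$. The completion of a finite program $\Gamma$ consists of the completed definitions of all predicate symbols occurring in $\Gamma$ and the universal closures of the formula representations of all constraints of $\Gamma$. Stable models. Infinitary formulas over a set of atoms: atoms, $\bot$, $\mathcal H^\wedge$ and $\mathcal H^\vee$ for any set $\mathcal H$ of infinitary formulas, and $G\to H$; $\neg F$ is $F\to\bot$, $\top$ is $\bot\to\bot$; satisfaction is classical. The reduct $F^{\mathcal I}$ is $\bot$ if $\mathcal I\not\models F$, and otherwise: $A$ for an atom $A$; $\{G^{\mathcal I}:G\in\mathcal H\}^\wedge$ resp. $^\vee$ for $\mathcal H^\wedge$, $\mathcal H^\vee$; $G^{\mathcal I}\to H^{\mathcal I}$ for $G\to H$. $\mathcal I$ is a stable model of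 $F$ if it is a minimal (w.r.t. inclusion) set of atoms satisfying $F^{\mathcal I}$. Translation $\tau$: for a ground atom, $\tau p(\mathbf t)=\bigvee_{\mathbf r\in[\mathbf t]}p(\mathbf r)$; $\tau(\mathit{not}\ p(\mathbf t))=\bigvee_{\mathbf r\in[\mathbf t]}\neg p(\mathbf r)$; for a ground comparison, $\tau(t_1\prec t_2)$ is $\top$ if $r_1\prec r_2$ for some $r_1\in[t_1],r_2\in[t_2]$, else $\bot$. An aggregate expression $E=\alpha\{\mathbf t:\mathbf C\}\prec s$ is closed if $s$ is ground; let $\mathbf X$ list its variables, $A$ the set of tuples of precomputed terms of length $|\mathbf X|$, and for $\Delta\subseteq A$ let $[\Delta]=\bigcup_{\mathbf r\in\Delta}[\mathbf t^{\mathbf X}_{\mathbf r}]$; $\Delta$ justifies $E$ if $\widehat\alpha([\Delta])\prec s$. Then $\tau E$ is the conjunction, over all $\Delta\subseteq A$ not justifying $E$, of $\bigwedge_{\mathbf r\in\Delta}\tau(\mathbf C^{\mathbf X}_{\mathbf r})\to\bigvee_{\mathbf r\in A\setminus\Delta}\tau(\mathbf C^{\mathbf X}_{\mathbf r})$. $\tau$ acts conjunct-wise on conjunctions. A rule is closed if all its variables are local; for closed rules: $\tau(p(\mathbf t)\leftarrow\mathit{Body})=\tau(\mathit{Body})\to\bigwedge_{\mathbf r\in[\mathbf t]}p(\mathbf r)$; $\tau(\{p(\mathbf t)\}\leftarrow\mathit{Body})=\tau(\mathit{Body})\to\bigwedge_{\mathbf r\in[\mathbf t]}(p(\mathbf r)\vee\neg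 p(\mathbf r))$; $\tau(\leftarrow\mathit{Body})=\neg\tau(\mathit{Body})$. An instance of a rule is the closed rule obtained by substituting precomputed terms for its global variables. $\tau\Gamma$ is the conjunction of $\tau R$ over all instances $R$ of rules of $\Gamma$, and the stable models of $\Gamma$ are the stable models of $\tau\Gamma$ (as sets of atoms from the vocabulary of $\Gamma$). -}

module Defs where

open import Level using (0ℓ)
open import Axiom.ExcludedMiddle using (ExcludedMiddle)
open import Data.Nat as ℕ using (ℕ; zero; suc; _≡ᵇ_; _+_)
open import Data.Integer as ℤ using (ℤ)
open import Data.Bool using (Bool; true; false; if_then_else_; not)
open import Data.Maybe using (Maybe; just; nothing; maybe)
open import Data.List as L using (List; []; _∷_; _++_; map; length; concatMap; zipWith; upTo; deduplicateᵇ; filterᵇ; mapMaybe; lookup)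
open import Data.Bool.ListAction using (any)
open import Data.List.NonEmpty as L⁺ using (List⁺; toList)
open import Data.Vec as V using (Vec; []; _∷_)
open import Data.Fin using (Fin)
open import Data.Product using (Σ; _×_; _,_; proj₁; proj₂)
open import Data.Unit using (⊤; tt)
open import Data.Empty using (⊥)
open import Relation.Nullary using (¬_; Dec; yes; no; does)
open import Relation.Binary.PropositionalEquality using (_≡_; _≢_)
open import Relation.Binary.Structures using (IsTotalOrder)
open import Relation.Binary.Construct.Closure.Transitive using (TransClosure)
open import Data.List.Membership.Propositional using (_∈_)
open import Data.List.Relation.Unary.All using (All)

-- Precomputed terms over a set Sym of symbolic constants:
-- numerals (identified with ℤ via the bijection n ↦ n̄), symbolic
-- constants, inf, sup, and f(r₁,…,rₙ) with n ≥ 1.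

data PT (S : Set) : Set where
  pnum : ℤ → PT S
  psym : S → PT S
  pinf psup : PT S
  papp : S → PT S → List (PT S) → PT S

-- The fixed data of the paper: symbolic constants, operation names with
-- arities and partial functions on ℤ, aggregate names with functions
-- on sets of tuples (sets = predicates, hence the extensionality
-- requirement), and the fixed total order on precomputed terms.

record Signature : Set₁ where
  field
    Sym      : Set
    Op       : Set
    arity    : Op → ℕ
    opf      : (o : Op) → Vec ℤ (arity o) → Maybe ℤ
    Agg      : Set
    aggf     : Agg → (List (PT Sym) → Set) → PT Sym
    aggf-ext : ∀ α (T T′ : List (PT Sym) → Set) →
               (∀ x → (T x → T′ x) × (T′ x → T x)) → aggf α T ≡ aggf α T′
    _≼_          : PT Sym → PT Sym → Set
    ≼-totalOrder : IsTotalOrder _≡_ _≼_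
    inf-least    : ∀ r → pinf ≼ r
    sup-greatest : ∀ r → r ≼ psup
    num-≼        : ∀ m n → pnum m ≼ pnum n → m ℤ.≤ n
    ≤-num        : ∀ m n → m ℤ.≤ n → pnum m ≼ pnum n

module Lang (S : Signature) (lem : ExcludedMiddle 0ℓ) where
  open Signature S

  P : Set
  P = PT Sym

  data RelSym : Set where
    eq neq lt gt le ge : RelSym

  relSem : RelSym → P → P → Set
  relSem eq  r s = r ≡ s
  relSem neq r s = r ≢ s
  relSem lt  r s = r ≼ s × r ≢ s
  relSem gt  r s = s ≼ r × r ≢ s
  relSem le  r s = r ≼ s
  relSem ge  r s = s ≼ r

  data Term : Set where
    num   : ℤ → Term
    sym   : Sym → Term
    var   : ℕ → Term
    inf sup : Term
    app   : Sym → Term → List Term → Term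
    op    : (o : Op) → Vec Term (arity o) → Term
    range : Term → Term → Term

  mutual
    ptTerm : P → Term
    ptTerm (pnum n) = num n
    ptTerm (psym c) = sym c
    ptTerm pinf = inf
    ptTerm psup = sup
    ptTerm (papp f r rs) = app f (ptTerm r) (ptTerms rs)

    ptTerms : List P → List Term
    ptTerms [] = []
    ptTerms (r ∷ rs) = ptTerm r ∷ ptTerms rs

  mutual
    ⟦_⟧ : Term → P → Set
    ⟦ num n ⟧ r = r ≡ pnum n
    ⟦ sym c ⟧ r = r ≡ psym c
    ⟦ var _ ⟧ r = ⊥
    ⟦ inf ⟧ r = r ≡ pinf
    ⟦ sup ⟧ r = r ≡ psup
    ⟦ app f t ts ⟧ r =
      Σ P λ r₀ → Σ (List P) λ rs → ⟦ t ⟧ r₀ × ⟦ ts ⟧ᴸ rs × r ≡ papp f r₀ rs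
    ⟦ op o ts ⟧ r =
      Σ (Vec ℤ (arity o)) λ ks → ⟦ ts ⟧ⱽ ks × Σ ℤ λ m → opf o ks ≡ just m × r ≡ pnum m
    ⟦ range a b ⟧ r =
      Σ ℤ λ m → r ≡ pnum m × Σ ℤ λ k₁ → Σ ℤ λ k₂ →
        ⟦ a ⟧ (pnum k₁) × ⟦ b ⟧ (pnum k₂) × k₁ ℤ.≤ m × m ℤ.≤ k₂

    ⟦_⟧ᴸ : List Term → List P → Set
    ⟦ [] ⟧ᴸ [] = ⊤
    ⟦ t ∷ ts ⟧ᴸ (r ∷ rs) = ⟦ t ⟧ r × ⟦ ts ⟧ᴸ rs
    ⟦ _ ⟧ᴸ _ = ⊥

    ⟦_⟧ⱽ : ∀ {n} → Vec Term n → Vec ℤ n → Set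
    ⟦ [] ⟧ⱽ [] = ⊤
    ⟦ t ∷ ts ⟧ⱽ (k ∷ ks) = ⟦ t ⟧ (pnum k) × ⟦ ts ⟧ⱽ ks

  Sub : Set
  Sub = ℕ → Maybe P

  mutual
    sT : Sub → Term → Term
    sT σ (num n) = num n
    sT σ (sym c) = sym c
    sT σ (var v) = maybe ptTerm (var v) (σ v)
    sT σ inf = inf
    sT σ sup = sup
    sT σ (app f t ts) = app f (sT σ t) (sTs σ ts)
    sT σ (op o ts) = op o (sTv σ ts)
    sT σ (range a b) = range (sT σ a) (sT σ b)

    sTs : Sub → List Term → List Term
    sTs σ [] = []
    sTs σ (t ∷ ts) = sT σ t ∷ sTs σ ts

    sTv : ∀ {n} → Sub → Vec Term n → Vec Term n
    sTv σ [] = []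
    sTv σ (t ∷ ts) = sT σ t ∷ sTv σ ts

  mutual
    varsT : Term → List ℕ
    varsT (var v) = v ∷ []
    varsT (app f t ts) = varsT t ++ varsTs ts
    varsT (op o ts) = varsTv ts
    varsT (range a b) = varsT a ++ varsT b
    varsT _ = []

    varsTs : List Term → List ℕ
    varsTs [] = []
    varsTs (t ∷ ts) = varsT t ++ varsTs ts

    varsTv : ∀ {n} → Vec Term n → List ℕ
    varsTv [] = []
    varsTv (t ∷ ts) = varsT t ++ varsTv ts

  -- Programs

  SAtom : Set
  SAtom = Sym × List Term

  data Lit : Set where
    pos : SAtom → Lit
    neg : SAtom → Lit

  data CElem : Set where
    lit : Lit → CElem
    cmp : RelSym → Term → Term → CElem

  data Bound : Set where
    bvar : ℕ → Bound
    bpt  : P → Bound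

  data BElem : Set where
    cel  : CElem → BElem
    -- α{t : C} ≺ s
    aggE : Agg → List⁺ Term → List CElem → RelSym → Bound → BElem

  data Head : Set where
    basic      : SAtom → Head
    choice     : SAtom → Head
    constraint : Head

  record Rule : Set where
    constructor _⟵_
    field
      head : Head
      body : List BElem
  open Rule public

  Program : Set
  Program = List Rule

  sAtom : Sub → SAtom → SAtom
  sAtom σ (p , ts) = p , sTs σ ts

  sLit : Sub → Lit → Lit
  sLit σ (pos a) = pos (sAtom σ a)
  sLit σ (neg a) = neg (sAtom σ a)

  sCE : Sub → CElem → CElem
  sCE σ (lit l) = lit (sLit σ l)
  sCE σ (cmp r a b) = cmp r (sT σ a) (sT σ b)

  sBound : Sub → Bound → Bound
  sBound σ (bvar v) = maybe bpt (bvar v) (σ v)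
  sBound σ (bpt r) = bpt r

  sBE : Sub → BElem → BElem
  sBE σ (cel c) = cel (sCE σ c)
  sBE σ (aggE α t C r s) = aggE α (L⁺.map (sT σ) t) (map (sCE σ) C) r (sBound σ s)

  sHead : Sub → Head → Head
  sHead σ (basic a) = basic (sAtom σ a)
  sHead σ (choice a) = choice (sAtom σ a)
  sHead σ constraint = constraint

  sRule : Sub → Rule → Rule
  sRule σ (h ⟵ B) = sHead σ h ⟵ map (sBE σ) B

  varsA : SAtom → List ℕ
  varsA (_ , ts) = varsTs ts

  varsL : Lit → List ℕ
  varsL (pos a) = varsA a
  varsL (neg a) = varsA a

  varsCE : CElem → List ℕ
  varsCE (lit l) = varsL l
  varsCE (cmp _ a b) = varsT a ++ varsT b

  varsBound : Bound → List ℕ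
  varsBound (bvar v) = v ∷ []
  varsBound (bpt _) = []

  varsH : Head → List ℕ
  varsH (basic a) = varsA a
  varsH (choice a) = varsA a
  varsH constraint = []

  varsAgg : List⁺ Term → List CElem → Bound → List ℕ
  varsAgg t C s = deduplicateᵇ _≡ᵇ_ (varsTs (toList t) ++ concatMap varsCE C ++ varsBound s)

  varsBE : BElem → List ℕ
  varsBE (cel c) = varsCE c
  varsBE (aggE _ t C _ s) = varsAgg t C s

  -- variables occurring outside the left-hand parts α{t : C}
  globalBE : BElem → List ℕ
  globalBE (cel c) = varsCE c
  globalBE (aggE _ _ _ _ s) = varsBound s

  _∈ᵇ_ : ℕ → List ℕ → Bool
  v ∈ᵇ vs = any (_≡ᵇ v) vs

  globalVars : Rule → List ℕ
  globalVars (h ⟵ B) = deduplicateᵇ _≡ᵇ_ (varsH h ++ concatMap globalBE B)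

  localVars : Rule → List ℕ
  localVars R@(h ⟵ B) =
    filterᵇ (λ v → not (v ∈ᵇ globalVars R))
            (deduplicateᵇ _≡ᵇ_ (varsH h ++ concatMap varsBE B))

  -- Predicate symbols, tightness, vocabulary

  PredSym : Set
  PredSym = Sym × ℕ

  predA : SAtom → PredSym
  predA (p , ts) = p , length ts

  predsL : Lit → List PredSym
  predsL (pos a) = predA a ∷ []
  predsL (neg a) = predA a ∷ []

  predsCE : CElem → List PredSym
  predsCE (lit l) = predsL l
  predsCE (cmp _ _ _) = []

  predsBE : BElem → List PredSym
  predsBE (cel c) = predsCE c
  predsBE (aggE _ _ C _ _) = concatMap predsCE C

  predsH : Head → List PredSym
  predsH (basic a) = predA a ∷ []
  predsH (choice a) = predA a ∷ []
  predsH constraint = []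

  posBE : BElem → List PredSym
  posBE (cel (lit (pos a))) = predA a ∷ []
  posBE (cel (lit (neg a))) = []
  posBE (cel (cmp _ _ _)) = []
  posBE (aggE _ _ C _ _) = concatMap predsCE C

  predsR : Rule → List PredSym
  predsR (h ⟵ B) = predsH h ++ concatMap predsBE B

  preds : Program → List PredSym
  preds Γ = concatMap predsR Γ

  Edge : Program → PredSym → PredSym → Set
  Edge Γ q p = Σ (Fin (length Γ)) λ i →
    q ∈ predsH (head (lookup Γ i)) × p ∈ concatMap posBE (body (lookup Γ i))

  Tight : Program → Set
  Tight Γ = ∀ v → ¬ TransClosure (Edge Γ) v v

  Atom : Set
  Atom = Sym × List P

  Interp : Set₁
  Interp = Atom → Set

  _⊆_ : Interp → Interp → Set
  I ⊆ J = ∀ a → I a → J a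

  InVocab : Program → Interp → Set
  InVocab Γ I = ∀ p rs → I (p , rs) → (p , length rs) ∈ preds Γ

  -- Formulas and arguments

  -- variables of formulas: those of programs (pv) and new ones (nv)
  data FVar : Set where
    pv nv : ℕ → FVar

  eqFV : FVar → FVar → Bool
  eqFV (pv a) (pv b) = a ≡ᵇ b
  eqFV (nv a) (nv b) = a ≡ᵇ b
  eqFV _ _ = false

  mutual
    data Arg : Set where
      aPT  : P → Arg              -- numerals, constants, inf, sup, f(…) precomputed
      aVar : FVar → Arg
      aApp : Sym → Arg → List Arg → Arg
      aAgg : Agg → List FVar → Formula → Arg

    data Formula : Set where
      fAtom : Sym → List Arg → Formula
      fCmp  : RelSym → Arg → Arg → Formula
      fMem  : Arg → Term → Formula
      fBot  : Formula
      _f⇒_  : Formula → Formula → Formula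
      fAll  : FVar → Formula → Formula

  infixr 4 _f⇒_

  f¬ : Formula → Formula
  f¬ F = F f⇒ fBot

  fTop : Formula
  fTop = fBot f⇒ fBot

  _f∧_ : Formula → Formula → Formula
  F f∧ G = f¬ (F f⇒ f¬ G)

  _f∨_ : Formula → Formula → Formula
  F f∨ G = f¬ F f⇒ G

  _f⇔_ : Formula → Formula → Formula
  F f⇔ G = (F f⇒ G) f∧ (G f⇒ F)

  fEx : FVar → Formula → Formula
  fEx X F = f¬ (fAll X (f¬ F))

  exs : List FVar → Formula → Formula
  exs [] F = F
  exs (X ∷ Xs) F = fEx X (exs Xs F)

  alls : List FVar → Formula → Formula
  alls [] F = F
  alls (X ∷ Xs) F = fAll X (alls Xs F)

  conjL : List Formula → Formula
  conjL [] = fTop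
  conjL (F ∷ []) = F
  conjL (F ∷ G ∷ Fs) = F f∧ conjL (G ∷ Fs)

  disjL : List Formula → Formula
  disjL [] = fBot
  disjL (F ∷ []) = F
  disjL (F ∷ G ∷ Fs) = F f∨ disjL (G ∷ Fs)

  Env : Set
  Env = FVar → P

  upd : Env → FVar → P → Env
  upd ρ x r y = if eqFV x y then r else ρ y

  extend : Env → List FVar → List P → Env
  extend ρ (x ∷ xs) (r ∷ rs) = extend (upd ρ x r) xs rs
  extend ρ _ _ = ρ

  mutual
    evalA : Interp → Env → Arg → P
    evalA I ρ (aPT r) = r
    evalA I ρ (aVar x) = ρ x
    evalA I ρ (aApp f a as) = papp f (evalA I ρ a) (evalAs I ρ as)
    evalA I ρ (aAgg α xs F) =
      aggf α (λ rs → length rs ≡ length xs × sat I (extend ρ xs rs) F)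

    evalAs : Interp → Env → List Arg → List P
    evalAs I ρ [] = []
    evalAs I ρ (a ∷ as) = evalA I ρ a ∷ evalAs I ρ as

    sat : Interp → Env → Formula → Set
    sat I ρ (fAtom p as) = I (p , evalAs I ρ as)
    sat I ρ (fCmp r a b) = relSem r (evalA I ρ a) (evalA I ρ b)
    sat I ρ (fMem a t) = ⟦ sT (λ v → just (ρ (pv v))) t ⟧ (evalA I ρ a)
    sat I ρ fBot = ⊥
    sat I ρ (F f⇒ G) = sat I ρ F → sat I ρ G
    sat I ρ (fAll x F) = ∀ r → sat I (upd ρ x r) F

  dropVs : List FVar → List FVar → List FVar
  dropVs xs = filterᵇ (λ y → not (any (eqFV y) xs))

  mutual
    fvA : Arg → List FVar
    fvA (aPT _) = []
    fvA (aVar x) = x ∷ []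
    fvA (aApp _ a as) = fvA a ++ fvAs as
    fvA (aAgg _ xs F) = dropVs xs (fvF F)

    fvAs : List Arg → List FVar
    fvAs [] = []
    fvAs (a ∷ as) = fvA a ++ fvAs as

    fvF : Formula → List FVar
    fvF (fAtom _ as) = fvAs as
    fvF (fCmp _ a b) = fvA a ++ fvA b
    fvF (fMem a t) = fvA a ++ map pv (varsT t)
    fvF fBot = []
    fvF (F f⇒ G) = fvF F ++ fvF G
    fvF (fAll x F) = dropVs (x ∷ []) (fvF F)

  -- Formula representation φ, φ^X, and the completion

  newVs : ℕ → ℕ → List FVar
  newVs k n = map (λ i → nv (k + i)) (upTo n)

  mems : List FVar → List Term → List Formula
  mems = zipWith (λ X t → fMem (aVar X) t)

  φL : Lit → Formula
  φL (pos (p , ts)) = let Xs = newVs 0 (length ts) in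
    exs Xs (conjL (mems Xs ts) f∧ fAtom p (map aVar Xs))
  φL (neg (p , ts)) = let Xs = newVs 0 (length ts) in
    exs Xs (conjL (mems Xs ts) f∧ f¬ (fAtom p (map aVar Xs)))

  φC : CElem → Formula
  φC (lit l) = φL l
  φC (cmp r t₁ t₂) = exs (nv 0 ∷ nv 1 ∷ [])
    (conjL (fMem (aVar (nv 0)) t₁ ∷ fMem (aVar (nv 1)) t₂ ∷
            fCmp r (aVar (nv 0)) (aVar (nv 1)) ∷ []))

  φCs : List CElem → Formula
  φCs C = conjL (map φC C)

  boundTerm : Bound → Term
  boundTerm (bvar v) = var v
  boundTerm (bpt r) = ptTerm r

  φX : List ℕ → BElem → Formula
  φX X (cel c) = φC c
  φX X (aggE α t C r s) =
    let Y = nv 0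
        Z = newVs 1 (L⁺.length t)
    in exs (Y ∷ [])
         (fCmp r (aAgg α Z (exs (map pv X) (conjL (mems Z (toList t)) f∧ φCs C)))
                 (aVar Y)
          f∧ fMem (aVar Y) (boundTerm s))

  φBody : List ℕ → List BElem → Formula
  φBody X B = conjL (map (φX X) B)

  -- F_i for the rule R in the definition of p/n (V = nv 0, …, nv (n-1))
  defF : Sym → ℕ → Rule → Maybe Formula
  defF p n R@(basic (q , ts) ⟵ B) with lem {q ≡ p} | ℕ._≟_ (length ts) n
  ... | yes _ | yes _ =
    just (conjL (mems (newVs 0 n) ts) f∧ φBody (localVars R) B)
  ... | _ | _ = nothing
  defF p n R@(choice (q , ts) ⟵ B) with lem {q ≡ p} | ℕ._≟_ (length ts) n
  ... | yes _ | yes _ =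
    just ((conjL (mems (newVs 0 n) ts) f∧ φBody (localVars R) B)
          f∧ fAtom p (map aVar (newVs 0 n)))
  ... | _ | _ = nothing
  defF p n (constraint ⟵ B) = nothing

  completedDef : Program → PredSym → Formula
  completedDef Γ (p , n) =
    let V = newVs 0 n in
    alls V (fAtom p (map aVar V) f⇔
            disjL (map (λ F → exs (dropVs V (fvF F)) F) (mapMaybe (defF p n) Γ)))

  constraintF : Rule → Maybe Formula
  constraintF R@(constraint ⟵ B) =
    let F = f¬ (φBody (localVars R) B) in just (alls (fvF F) F)
  constraintF _ = nothing

  completion : Program → List Formula
  completion Γ = map (completedDef Γ) (preds Γ) ++ mapMaybe constraintF Γ

  -- I satisfies the completion (all its formulas are closed)
  SatCompletion : Program → Interp → Set
  SatCompletion Γ I = All (sat I (λ _ → pinf)) (completion Γ)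

  -- Infinitary formulas, reduct, stable models

  data IF : Set₁ where
    atm : Atom → IF
    ⊥I  : IF
    ⋀ ⋁ : (J : Set) → (J → IF) → IF
    _⇒I_ : IF → IF → IF

  ¬I : IF → IF
  ¬I F = F ⇒I ⊥I

  ⊤I : IF
  ⊤I = ⊥I ⇒I ⊥I

  _⊨_ : Interp → IF → Set
  I ⊨ atm a = I a
  I ⊨ ⊥I = ⊥
  I ⊨ ⋀ J F = ∀ j → I ⊨ F j
  I ⊨ ⋁ J F = Σ J λ j → I ⊨ F j
  I ⊨ (G ⇒I H) = I ⊨ G → I ⊨ H

  mutual
    reduct : Interp → IF → IF
    reduct I F = if does (lem {I ⊨ F}) then reduct′ I F else ⊥I

    reduct′ : Interp → IF → IF
    reduct′ I (atm a) = atm a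
    reduct′ I ⊥I = ⊥I
    reduct′ I (⋀ J F) = ⋀ J (λ j → reduct I (F j))
    reduct′ I (⋁ J F) = ⋁ J (λ j → reduct I (F j))
    reduct′ I (G ⇒I H) = reduct I G ⇒I reduct I H

  StableIF : IF → Interp → Set₁
  StableIF F I = I ⊨ reduct I F ×
    (∀ J → J ⊆ I → ¬ (I ⊆ J) → ¬ (J ⊨ reduct I F))

  τLit : Lit → IF
  τLit (pos (p , ts)) = ⋁ (Σ (List P) λ rs → ⟦ ts ⟧ᴸ rs) λ x → atm (p , proj₁ x)
  τLit (neg (p , ts)) = ⋁ (Σ (List P) λ rs → ⟦ ts ⟧ᴸ rs) λ x → ¬I (atm (p , proj₁ x))

  τC : CElem → IF
  τC (lit l) = τLit l
  τC (cmp r t₁ t₂) =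
    if does (lem {Σ P λ r₁ → Σ P λ r₂ → ⟦ t₁ ⟧ r₁ × ⟦ t₂ ⟧ r₂ × relSem r r₁ r₂})
    then ⊤I else ⊥I

  τCs : List CElem → IF
  τCs C = ⋀ (Fin (length C)) (λ i → τC (lookup C i))

  assoc : List ℕ → List P → Sub
  assoc (x ∷ xs) (r ∷ rs) v = if x ≡ᵇ v then just r else assoc xs rs v
  assoc _ _ v = nothing

  justifies : Agg → RelSym → Bound → (List P → Set) → Set
  justifies α r (bvar _) T = ⊥     -- does not arise for closed expressions
  justifies α r (bpt s) T = relSem r (aggf α T) s

  τB : BElem → IF
  τB (cel c) = τC c
  τB (aggE α t C r s) =
    ⋀ (Σ (Vec P k → Bool) λ Δ → ¬ justifies α r s (setΔ Δ)) λ x →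
      (⋀ (Σ (Vec P k) λ v → proj₁ x v ≡ true) λ y → τCs (Cv (proj₁ y)))
      ⇒I (⋁ (Σ (Vec P k) λ v → proj₁ x v ≡ false) λ y → τCs (Cv (proj₁ y)))
    where
      X = varsAgg t C s
      k = length X
      σ : Vec P k → Sub
      σ v = assoc X (V.toList v)
      Cv : Vec P k → List CElem
      Cv v = map (sCE (σ v)) C
      setΔ : (Vec P k → Bool) → List P → Set
      setΔ Δ rs = Σ (Vec P k) λ v → Δ v ≡ true × ⟦ sTs (σ v) (toList t) ⟧ᴸ rs

  τBody : List BElem → IF
  τBody B = ⋀ (Fin (length B)) (λ i → τB (lookup B i))

  τR : Rule → IF
  τR (basic (p , ts) ⟵ B) =
    τBody B ⇒I ⋀ (Σ (List P) λ rs → ⟦ ts ⟧ᴸ rs) (λ x → atm (p , proj₁ x))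
  τR (choice (p , ts) ⟵ B) =
    τBody B ⇒I ⋀ (Σ (List P) λ rs → ⟦ ts ⟧ᴸ rs)
      (λ x → ⋁ Bool λ b → if b then atm (p , proj₁ x) else ¬I (atm (p , proj₁ x)))
  τR (constraint ⟵ B) = ¬I (τBody B)

  instance′ : Rule → (ℕ → P) → Rule
  instance′ R ρ = sRule (λ v → if v ∈ᵇ globalVars R then just (ρ v) else nothing) R

  τΓ : Program → IF
  τΓ Γ = ⋀ (Fin (length Γ) × (ℕ → P)) λ x → τR (instance′ (lookup Γ (proj₁ x)) (proj₂ x))

  StableModel : Program → Interp → Set₁
  StableModel Γ I = InVocab Γ I × StableIF (τΓ Γ) I

module Submission where

-- Through the formula representation φ, the completion of Γ says exactly that I is a supported model:
-- an atom p(r) of a predicate of Γ is in I iff some instance of a rule for p has p(r) among its head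
-- atoms and a body true in I (for a choice rule, p(r) must moreover be in I), and no instance of a
-- constraint body is true in I.  This rests on φ and the infinitary translation τ agreeing on every
-- rule instance.  For an aggregate expression, the set denoted by the aggregate term of φ is [Δᴵ],
-- where Δᴵ collects the tuples whose instantiated conditions hold in I, and τ of the expression holds
-- in I iff Δᴵ justifies it.
-- A stable model is supported: removing an unsupported atom would leave a smaller model of the
-- reduct.  Conversely, let I be a supported model within the vocabulary and J a model of the reduct
-- of τΓ relative to I.  Tightness makes the positive dependency graph well founded, and by induction
-- along it every atom of I is in J: the reduct of the body of its supporting instance only asks for
-- atoms in positive positions, whose predicates lie lower in the graph.  Hence I is minimal.

open import Defs
open import Level using (0ℓ)
open import Axiom.ExcludedMiddle using (ExcludedMiddle)
open import Axiom.DoubleNegationElimination using (em⇒dne)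
open import Function using (_∘_; flip; id; case_of_)
open import Function.Bundles using (_⇔_; mk⇔; Equivalence)
open import Function.Related.Propositional using (module EquationalReasoning; Kind)
import Function.Properties.Equivalence as ⇔
open import Data.Nat as ℕ using (ℕ; zero; suc; _≡ᵇ_; _+_; _<_; _≤_; s≤s)
import Data.Nat.Properties as ℕP
open import Data.Bool using (Bool; true; false; if_then_else_; not; T)
open import Data.Bool.Properties using (T-≡; T-not-≡)
open import Data.Bool.ListAction using (any)
open import Data.Maybe using (just; nothing; maybe)
open import Data.Vec as V using (Vec)
import Data.Vec.Properties as VP
import Data.List.NonEmpty as L⁺
open import Data.Fin as Fin using (Fin; toℕ)
open import Data.Fin.Properties using (pigeonhole; toℕ<n)
open import Data.List
  using (List; []; _∷_; _++_; map; length; concatMap; upTo; deduplicateᵇ; mapMaybe; lookup)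
import Data.List.Properties as LP
open import Data.List.Relation.Unary.All as All using (All; []; _∷_)
import Data.List.Relation.Unary.All.Properties as AllP
open import Data.List.Relation.Unary.Any as Any using (Any; here; there)
import Data.List.Relation.Unary.Any.Properties as AnyP
open AnyP using (lookup-index; any⁺; any⁻)
open import Data.List.Relation.Unary.Unique.Propositional using (Unique; _∷_)
import Data.List.Relation.Unary.Unique.Propositional.Properties as UniqueP
open import Data.List.Membership.Propositional using (_∈_; _∉_; find; lose)
import Data.List.Membership.Propositional.Properties as ∈P
import Data.List.Membership.Setoid.Properties as ∈SP
open import Data.Product using (Σ; _×_; _,_; proj₁; proj₂)
open import Data.Product.Function.NonDependent.Propositional using (_×-⇔_)
open import Data.Sum using (_⊎_; inj₁; inj₂; [_,_]′)
open import Data.Unit using (⊤; tt)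
open import Data.Empty using (⊥; ⊥-elim)
open import Relation.Nullary using (¬_; yes; no; does)
open import Relation.Nullary.Decidable using (dec-true; T?)
open import Relation.Binary.Core using (Rel)
open import Induction.WellFounded using (Acc; acc; WellFounded)
open import Relation.Binary.Construct.Closure.Transitive using (TransClosure; [_]; _∷ʳ_)
open import Relation.Binary.PropositionalEquality

open Equivalence using (to; from)

≡⇒⇔ : {A B : Set} → A ≡ B → A ⇔ B
≡⇒⇔ refl = ⇔.refl

∈-concatMap : ∀ {A B : Set} (f : A → List B) {xs x y} → x ∈ xs → y ∈ f x → y ∈ concatMap f xs
∈-concatMap f x∈ y∈ = ∈P.∈-concatMap⁺ f (lose x∈ y∈)

∈-++-map : ∀ {A : Set} {xs ys xs′ ys′ : List A} {u} → (u ∈ xs → u ∈ xs′) → (u ∈ ys → u ∈ ys′) →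
           u ∈ xs ++ ys → u ∈ xs′ ++ ys′
∈-++-map {xs = xs} {xs′ = xs′} f g u∈ = [ ∈P.∈-++⁺ˡ ∘ f , ∈P.∈-++⁺ʳ xs′ ∘ g ]′ (∈P.∈-++⁻ xs u∈)

All-⇔ : ∀ {A : Set} {Q Q′ : A → Set} xs → (∀ {x} → x ∈ xs → Q x ⇔ Q′ x) → All Q xs ⇔ All Q′ xs
All-⇔ xs Q⇔Q′ = mk⇔ (λ qs → All.tabulate (λ x∈ → to (Q⇔Q′ x∈) (All.lookup qs x∈)))
                    (λ qs → All.tabulate (λ x∈ → from (Q⇔Q′ x∈) (All.lookup qs x∈)))

All-map : ∀ {A B : Set} {Q : B → Set} (f : A → B) xs → All Q (map f xs) ⇔ All (Q ∘ f) xs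
All-map f xs = mk⇔ AllP.map⁻ AllP.map⁺

Any-∷-⇔ : ∀ {A B : Set} {Q : A → Set} {Q′ : B → Set} {x y xs ys} →
          Q x ⇔ Q′ y → Any Q xs ⇔ Any Q′ ys → Any Q (x ∷ xs) ⇔ Any Q′ (y ∷ ys)
Any-∷-⇔ x⇔y xs⇔ys = mk⇔ (λ { (here q) → here (to x⇔y q) ; (there q) → there (to xs⇔ys q) })
                        (λ { (here q) → here (from x⇔y q) ; (there q) → there (from xs⇔ys q) })

Any-skip : ∀ {A B : Set} {Q : A → Set} {Q′ : B → Set} {y xs ys} →
           ¬ Q′ y → Any Q xs ⇔ Any Q′ ys → Any Q xs ⇔ Any Q′ (y ∷ ys)
Any-skip ¬Q′y xs⇔ys =
  mk⇔ (there ∘ to xs⇔ys) (λ { (here q) → ⊥-elim (¬Q′y q) ; (there q) → from xs⇔ys q })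

-- Well-foundedness of acyclic finite relations

module _ {A : Set} {E : Rel A 0ℓ} where

  Walk : ℕ → (ℕ → A) → Set
  Walk k w = ∀ i → i < k → E (w i) (w (suc i))

  walk⇒path : ∀ {k w a b} → Walk k w → a < b → b ≤ k → TransClosure E (w a) (w b)
  walk⇒path {b = suc b} walk a<1+b 1+b≤k with ℕP.m<1+n⇒m<n∨m≡n a<1+b
  ... | inj₁ a<b = walk⇒path walk a<b (ℕP.<⇒≤ 1+b≤k) ∷ʳ walk b 1+b≤k
  ... | inj₂ refl = [ walk b 1+b≤k ]

  no-walk⇒acc : ∀ k v → (∀ w → w 0 ≡ v → ¬ Walk k w) → Acc (flip E) v
  no-walk⇒acc zero v noWalk = ⊥-elim (noWalk (λ _ → v) refl (λ _ ()))
  no-walk⇒acc (suc k) v noWalk = acc λ {u} v→u →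
    no-walk⇒acc k u λ w w0≡u walk → noWalk (cons w) refl (cons-walk w w0≡u walk v→u)
    where
    cons : (ℕ → A) → ℕ → A
    cons w zero = v
    cons w (suc i) = w i
    cons-walk : ∀ {u} w → w 0 ≡ u → Walk k w → E v u → Walk (suc k) (cons w)
    cons-walk w refl walk v→u zero _ = v→u
    cons-walk w refl walk v→u (suc i) (s≤s i<k) = walk i i<k

  acyclic⇒wellFounded : (vs : List A) → (∀ {x y} → E x y → x ∈ vs) →
                        (∀ x → ¬ TransClosure E x x) → WellFounded (flip E)
  acyclic⇒wellFounded vs source∈ acyclic v =
    no-walk⇒acc (suc (length vs)) v λ w _ → no-long-walk w
    where
    visited : ∀ {w} → Walk (suc (length vs)) w → (i : Fin (suc (length vs))) → w (toℕ i) ∈ vs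
    visited walk i = source∈ (walk (toℕ i) (toℕ<n i))

    no-long-walk : ∀ w → ¬ Walk (suc (length vs)) w
    no-long-walk w walk with pigeonhole ℕP.≤-refl (Any.index ∘ visited walk)
    ... | i , j , i<j , same-index = acyclic (w (toℕ i))
      (subst (TransClosure E (w (toℕ i))) w[j]≡w[i] (walk⇒path walk i<j (ℕP.<⇒≤ (toℕ<n j))))
      where
      open ≡-Reasoning
      w[j]≡w[i] : w (toℕ j) ≡ w (toℕ i)
      w[j]≡w[i] = begin
        w (toℕ j)                               ≡⟨ lookup-index (visited walk j) ⟩
        lookup vs (Any.index (visited walk j))  ≡⟨ cong (lookup vs) same-index ⟨
        lookup vs (Any.index (visited walk i))  ≡⟨ lookup-index (visited walk i) ⟨
        w (toℕ i)                               ∎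

-- Variables, environments and substitution

module Syntax (S : Signature) (lem : ExcludedMiddle 0ℓ) where
  open Signature S
  open Lang S lem renaming (sym to symbol)

  dne : {A : Set} → ¬ ¬ A → A
  dne = em⇒dne lem

  eqFV-refl : ∀ x → eqFV x x ≡ true
  eqFV-refl (pv a) = to T-≡ (ℕP.≡⇒≡ᵇ a a refl)
  eqFV-refl (nv a) = to T-≡ (ℕP.≡⇒≡ᵇ a a refl)

  eqFV⇒≡ : ∀ x y → eqFV x y ≡ true → x ≡ y
  eqFV⇒≡ (pv a) (pv b) e = cong pv (ℕP.≡ᵇ⇒≡ a b (from T-≡ e))
  eqFV⇒≡ (nv a) (nv b) e = cong nv (ℕP.≡ᵇ⇒≡ a b (from T-≡ e))

  eqFV-≢ : ∀ {x y} → x ≢ y → eqFV x y ≡ false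
  eqFV-≢ {x} {y} x≢y with eqFV x y in e
  ... | true = ⊥-elim (x≢y (eqFV⇒≡ x y e))
  ... | false = refl

  upd-≡ : ∀ ρ x r → upd ρ x r x ≡ r
  upd-≡ ρ x r rewrite eqFV-refl x = refl

  upd-≢ : ∀ ρ {x y} r → x ≢ y → upd ρ x r y ≡ ρ y
  upd-≢ ρ r x≢y rewrite eqFV-≢ x≢y = refl

  extend-∉ : ∀ ρ xs rs {y} → y ∉ xs → extend ρ xs rs y ≡ ρ y
  extend-∉ ρ [] rs _ = refl
  extend-∉ ρ (x ∷ xs) [] _ = refl
  extend-∉ ρ (x ∷ xs) (r ∷ rs) y∉ =
    trans (extend-∉ (upd ρ x r) xs rs (y∉ ∘ there)) (upd-≢ ρ r (λ x≡y → y∉ (here (sym x≡y))))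

  extend-map-≡ : ∀ ρ (w : FVar → P) xs {y} → ρ y ≡ w y → extend ρ xs (map w xs) y ≡ w y
  extend-map-≡ ρ w [] e = e
  extend-map-≡ ρ w (x ∷ xs) {y} e = extend-map-≡ (upd ρ x (w x)) w xs upd≡w
    where
    upd≡w : upd ρ x (w x) y ≡ w y
    upd≡w with eqFV x y in x≟y
    ... | true = cong w (eqFV⇒≡ x y x≟y)
    ... | false = e

  extend-map-∈ : ∀ ρ (w : FVar → P) xs {y} → y ∈ xs → extend ρ xs (map w xs) y ≡ w y
  extend-map-∈ ρ w (x ∷ xs) (here refl) = extend-map-≡ (upd ρ x (w x)) w xs (upd-≡ ρ x (w x))
  extend-map-∈ ρ w (x ∷ xs) (there y∈) = extend-map-∈ (upd ρ x (w x)) w xs y∈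

  map-extend : ∀ ρ xs rs → Unique xs → length rs ≡ length xs → map (extend ρ xs rs) xs ≡ rs
  map-extend ρ [] [] _ _ = refl
  map-extend ρ (x ∷ xs) (r ∷ rs) (x∉xs ∷ unique) e = cong₂ _∷_
    (trans (extend-∉ (upd ρ x r) xs rs (AllP.All¬⇒¬Any x∉xs)) (upd-≡ ρ x r))
    (map-extend (upd ρ x r) xs rs unique (ℕP.suc-injective e))

  newVs-∈ : ∀ {k n y} → y ∈ newVs k n → Σ ℕ λ i → y ≡ nv (k + i)
  newVs-∈ y∈ = let i , _ , e = ∈P.∈-map⁻ _ y∈ in i , e

  length-newVs : ∀ k n → length (newVs k n) ≡ n
  length-newVs k n = trans (LP.length-map _ (upTo n)) (LP.length-applyUpTo id n)

  pv∉newVs : ∀ k n v → pv v ∉ newVs k n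
  pv∉newVs k n v pv∈ with newVs-∈ pv∈
  ... | _ , ()

  unique-newVs : ∀ k n → Unique (newVs k n)
  unique-newVs k n =
    UniqueP.map⁺ (λ {i} {j} e → ℕP.+-cancelˡ-≡ k i j (nv-injective e)) (UniqueP.upTo⁺ n)
    where
    nv-injective : ∀ {a b} → nv a ≡ nv b → a ≡ b
    nv-injective refl = refl

  any-eqFV-∉ : ∀ {y} xs → y ∉ xs → any (eqFV y) xs ≡ false
  any-eqFV-∉ [] _ = refl
  any-eqFV-∉ (x ∷ xs) y∉ rewrite eqFV-≢ (λ y≡x → y∉ (here y≡x)) = any-eqFV-∉ xs (y∉ ∘ there)

  any-eqFV-∈ : ∀ {y} xs → y ∈ xs → T (any (eqFV y) xs)
  any-eqFV-∈ {y} xs y∈ = any⁺ _ (Any.map (λ { refl → from T-≡ (eqFV-refl y) }) y∈)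

  ∈-dropVs⁺ : ∀ {y} xs {L} → y ∈ L → y ∉ xs → y ∈ dropVs xs L
  ∈-dropVs⁺ xs y∈ y∉ = ∈P.∈-filter⁺ _ y∈ (from T-not-≡ (any-eqFV-∉ xs y∉))

  ∈-dropVs⁻ : ∀ {y} xs {L} → y ∈ dropVs xs L → y ∈ L × y ∉ xs
  ∈-dropVs⁻ xs y∈ = let y∈L , kept = ∈P.∈-filter⁻ _ y∈ in
    y∈L , λ y∈xs → subst T (to T-not-≡ kept) (any-eqFV-∈ xs y∈xs)

  envSub : Env → Sub
  envSub ρ v = just (ρ (pv v))

  globalEnv : (ℕ → P) → Env
  globalEnv ρg (pv x) = ρg x
  globalEnv ρg (nv _) = pinf

  _▹_ : Sub → Sub → Sub
  (σ ▹ τ) v = maybe just (τ v) (σ v)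

  Agree : Sub → Sub → List ℕ → Set
  Agree σ σ′ vs = ∀ v → v ∈ vs → σ v ≡ σ′ v

  Agree-++⁻ˡ : ∀ {σ σ′} xs {ys} → Agree σ σ′ (xs ++ ys) → Agree σ σ′ xs
  Agree-++⁻ˡ xs a v v∈ = a v (∈P.∈-++⁺ˡ v∈)

  Agree-++⁻ʳ : ∀ {σ σ′} xs {ys} → Agree σ σ′ (xs ++ ys) → Agree σ σ′ ys
  Agree-++⁻ʳ xs a v v∈ = a v (∈P.∈-++⁺ʳ xs v∈)

  mutual
    sT-ptTerm : ∀ σ r → sT σ (ptTerm r) ≡ ptTerm r
    sT-ptTerm σ (pnum x) = refl
    sT-ptTerm σ (psym x) = refl
    sT-ptTerm σ pinf = refl
    sT-ptTerm σ psup = refl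
    sT-ptTerm σ (papp f r rs) = cong₂ (app f) (sT-ptTerm σ r) (sTs-ptTerms σ rs)

    sTs-ptTerms : ∀ σ rs → sTs σ (ptTerms rs) ≡ ptTerms rs
    sTs-ptTerms σ [] = refl
    sTs-ptTerms σ (r ∷ rs) = cong₂ _∷_ (sT-ptTerm σ r) (sTs-ptTerms σ rs)

  mutual
    sT-▹ : ∀ σ τ t → sT τ (sT σ t) ≡ sT (σ ▹ τ) t
    sT-▹ σ τ (num x) = refl
    sT-▹ σ τ (symbol x) = refl
    sT-▹ σ τ (var v) with σ v
    ... | just r = sT-ptTerm τ r
    ... | nothing = refl
    sT-▹ σ τ inf = refl
    sT-▹ σ τ sup = refl
    sT-▹ σ τ (app f t ts) = cong₂ (app f) (sT-▹ σ τ t) (sTs-▹ σ τ ts)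
    sT-▹ σ τ (op o ts) = cong (op o) (sTv-▹ σ τ ts)
    sT-▹ σ τ (range a b) = cong₂ range (sT-▹ σ τ a) (sT-▹ σ τ b)

    sTs-▹ : ∀ σ τ ts → sTs τ (sTs σ ts) ≡ sTs (σ ▹ τ) ts
    sTs-▹ σ τ [] = refl
    sTs-▹ σ τ (t ∷ ts) = cong₂ _∷_ (sT-▹ σ τ t) (sTs-▹ σ τ ts)

    sTv-▹ : ∀ {n} σ τ (ts : Vec Term n) → sTv τ (sTv σ ts) ≡ sTv (σ ▹ τ) ts
    sTv-▹ σ τ V.[] = refl
    sTv-▹ σ τ (t V.∷ ts) = cong₂ V._∷_ (sT-▹ σ τ t) (sTv-▹ σ τ ts)

  mutual
    sT-cong : ∀ {σ σ′} t → Agree σ σ′ (varsT t) → sT σ t ≡ sT σ′ t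
    sT-cong (num x) a = refl
    sT-cong (symbol x) a = refl
    sT-cong (var v) a rewrite a v (here refl) = refl
    sT-cong inf a = refl
    sT-cong sup a = refl
    sT-cong (app f t ts) a =
      cong₂ (app f) (sT-cong t (Agree-++⁻ˡ (varsT t) a)) (sTs-cong ts (Agree-++⁻ʳ (varsT t) a))
    sT-cong (op o ts) a = cong (op o) (sTv-cong ts a)
    sT-cong (range t u) a =
      cong₂ range (sT-cong t (Agree-++⁻ˡ (varsT t) a)) (sT-cong u (Agree-++⁻ʳ (varsT t) a))

    sTs-cong : ∀ {σ σ′} ts → Agree σ σ′ (varsTs ts) → sTs σ ts ≡ sTs σ′ ts
    sTs-cong [] a = refl
    sTs-cong (t ∷ ts) a =
      cong₂ _∷_ (sT-cong t (Agree-++⁻ˡ (varsT t) a)) (sTs-cong ts (Agree-++⁻ʳ (varsT t) a))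

    sTv-cong : ∀ {n σ σ′} (ts : Vec Term n) → Agree σ σ′ (varsTv ts) → sTv σ ts ≡ sTv σ′ ts
    sTv-cong V.[] a = refl
    sTv-cong (t V.∷ ts) a =
      cong₂ V._∷_ (sT-cong t (Agree-++⁻ˡ (varsT t) a)) (sTv-cong ts (Agree-++⁻ʳ (varsT t) a))

  mutual
    varsT-sT : ∀ σ t {u} → σ u ≡ nothing → u ∈ varsT t → u ∈ varsT (sT σ t)
    varsT-sT σ (var v) e (here refl) rewrite e = here refl
    varsT-sT σ (app f t ts) e = ∈-++-map (varsT-sT σ t e) (varsTs-sTs σ ts e)
    varsT-sT σ (op o ts) e = varsTv-sTv σ ts e
    varsT-sT σ (range t u) e = ∈-++-map (varsT-sT σ t e) (varsT-sT σ u e)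

    varsTs-sTs : ∀ σ ts {u} → σ u ≡ nothing → u ∈ varsTs ts → u ∈ varsTs (sTs σ ts)
    varsTs-sTs σ (t ∷ ts) e = ∈-++-map (varsT-sT σ t e) (varsTs-sTs σ ts e)

    varsTv-sTv : ∀ {n} σ (ts : Vec Term n) {u} → σ u ≡ nothing → u ∈ varsTv ts → u ∈ varsTv (sTv σ ts)
    varsTv-sTv σ (t V.∷ ts) e = ∈-++-map (varsT-sT σ t e) (varsTv-sTv σ ts e)

  mutual
    ⟦ptTerm⟧⇒≡ : ∀ r {r′} → ⟦ ptTerm r ⟧ r′ → r′ ≡ r
    ⟦ptTerm⟧⇒≡ (pnum x) e = e
    ⟦ptTerm⟧⇒≡ (psym x) e = e
    ⟦ptTerm⟧⇒≡ pinf e = e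
    ⟦ptTerm⟧⇒≡ psup e = e
    ⟦ptTerm⟧⇒≡ (papp f r rs) (_ , _ , r∈ , rs∈ , refl) =
      cong₂ (papp f) (⟦ptTerm⟧⇒≡ r r∈) (⟦ptTerms⟧⇒≡ rs rs∈)

    ⟦ptTerms⟧⇒≡ : ∀ rs {rs′} → ⟦ ptTerms rs ⟧ᴸ rs′ → rs′ ≡ rs
    ⟦ptTerms⟧⇒≡ [] {[]} _ = refl
    ⟦ptTerms⟧⇒≡ (r ∷ rs) {_ ∷ _} (r∈ , rs∈) = cong₂ _∷_ (⟦ptTerm⟧⇒≡ r r∈) (⟦ptTerms⟧⇒≡ rs rs∈)

  mutual
    ⟦ptTerm⟧-refl : ∀ r → ⟦ ptTerm r ⟧ r
    ⟦ptTerm⟧-refl (pnum x) = refl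
    ⟦ptTerm⟧-refl (psym x) = refl
    ⟦ptTerm⟧-refl pinf = refl
    ⟦ptTerm⟧-refl psup = refl
    ⟦ptTerm⟧-refl (papp f r rs) = r , rs , ⟦ptTerm⟧-refl r , ⟦ptTerms⟧-refl rs , refl

    ⟦ptTerms⟧-refl : ∀ rs → ⟦ ptTerms rs ⟧ᴸ rs
    ⟦ptTerms⟧-refl [] = tt
    ⟦ptTerms⟧-refl (r ∷ rs) = ⟦ptTerm⟧-refl r , ⟦ptTerms⟧-refl rs

  ⟦ptTerm⟧ : ∀ r {r′} → ⟦ ptTerm r ⟧ r′ ⇔ r′ ≡ r
  ⟦ptTerm⟧ r = mk⇔ (⟦ptTerm⟧⇒≡ r) (λ { refl → ⟦ptTerm⟧-refl r })

  ⟦⟧ᴸ-length : ∀ ts {rs} → ⟦ ts ⟧ᴸ rs → length rs ≡ length ts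
  ⟦⟧ᴸ-length [] {[]} _ = refl
  ⟦⟧ᴸ-length (t ∷ ts) {_ ∷ _} (_ , rs∈) = cong suc (⟦⟧ᴸ-length ts rs∈)

  length-sTs : ∀ σ ts → length (sTs σ ts) ≡ length ts
  length-sTs σ [] = refl
  length-sTs σ (t ∷ ts) = cong suc (length-sTs σ ts)

  ⟦sTs⟧ᴸ-length : ∀ σ ts {rs} → ⟦ sTs σ ts ⟧ᴸ rs → length rs ≡ length ts
  ⟦sTs⟧ᴸ-length σ ts rs∈ = trans (⟦⟧ᴸ-length (sTs σ ts) rs∈) (length-sTs σ ts)

  map-sT : ∀ σ ts → map (sT σ) ts ≡ sTs σ ts
  map-sT σ [] = refl
  map-sT σ (t ∷ ts) = cong (sT σ t ∷_) (map-sT σ ts)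

  sCE-cong : ∀ {σ σ′} c → Agree σ σ′ (varsCE c) → sCE σ c ≡ sCE σ′ c
  sCE-cong (lit (pos (p , ts))) a = cong (λ ts → lit (pos (p , ts))) (sTs-cong ts a)
  sCE-cong (lit (neg (p , ts))) a = cong (λ ts → lit (neg (p , ts))) (sTs-cong ts a)
  sCE-cong (cmp r t u) a =
    cong₂ (cmp r) (sT-cong t (Agree-++⁻ˡ (varsT t) a)) (sT-cong u (Agree-++⁻ʳ (varsT t) a))

  sCE-▹ : ∀ σ τ c → sCE τ (sCE σ c) ≡ sCE (σ ▹ τ) c
  sCE-▹ σ τ (lit (pos (p , ts))) = cong (λ ts → lit (pos (p , ts))) (sTs-▹ σ τ ts)
  sCE-▹ σ τ (lit (neg (p , ts))) = cong (λ ts → lit (neg (p , ts))) (sTs-▹ σ τ ts)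
  sCE-▹ σ τ (cmp r t u) = cong₂ (cmp r) (sT-▹ σ τ t) (sT-▹ σ τ u)

  map-sCE-▹ : ∀ σ τ C → map (sCE τ) (map (sCE σ) C) ≡ map (sCE (σ ▹ τ)) C
  map-sCE-▹ σ τ C = trans (sym (LP.map-∘ C)) (LP.map-cong (sCE-▹ σ τ) C)

  varsCE-sCE : ∀ σ c {u} → σ u ≡ nothing → u ∈ varsCE c → u ∈ varsCE (sCE σ c)
  varsCE-sCE σ (lit (pos (p , ts))) e = varsTs-sTs σ ts e
  varsCE-sCE σ (lit (neg (p , ts))) e = varsTs-sTs σ ts e
  varsCE-sCE σ (cmp r t u) e = ∈-++-map (varsT-sT σ t e) (varsT-sT σ u e)

  varsCEs-sCEs : ∀ σ C {u} → σ u ≡ nothing →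
                 u ∈ concatMap varsCE C → u ∈ concatMap varsCE (map (sCE σ) C)
  varsCEs-sCEs σ (c ∷ C) e = ∈-++-map (varsCE-sCE σ c e) (varsCEs-sCEs σ C e)

  Agree-concatMap : ∀ {A : Set} {σ σ′} (f : A → List ℕ) {xs x} → x ∈ xs →
                    Agree σ σ′ (concatMap f xs) → Agree σ σ′ (f x)
  Agree-concatMap f x∈ a v v∈ = a v (∈-concatMap f x∈ v∈)

  ∈-deduplicateᵇ⁺ : ∀ {xs u} → u ∈ xs → u ∈ deduplicateᵇ _≡ᵇ_ xs
  ∈-deduplicateᵇ⁺ = ∈SP.∈-deduplicate⁺ (setoid ℕ) _ (λ z≡ᵇy x≡y → trans x≡y (sym (ℕP.≡ᵇ⇒≡ _ _ z≡ᵇy)))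

  ∈-deduplicateᵇ⁻ : ∀ xs {u} → u ∈ deduplicateᵇ _≡ᵇ_ xs → u ∈ xs
  ∈-deduplicateᵇ⁻ xs = ∈P.∈-deduplicate⁻ _ xs

  assoc-map : ∀ (g : ℕ → P) xs {u} → u ∈ xs → assoc xs (map g xs) u ≡ just (g u)
  assoc-map g (x ∷ xs) {u} u∈ with x ≡ᵇ u in x≟u | u∈
  ... | true | _ = cong (just ∘ g) (ℕP.≡ᵇ⇒≡ x u (from T-≡ x≟u))
  ... | false | here refl = ⊥-elim (subst T x≟u (ℕP.≡⇒≡ᵇ x x refl))
  ... | false | there u∈xs = assoc-map g xs u∈xs

  assoc-defined : ∀ xs rs {u} → u ∈ xs → length rs ≡ length xs → Σ P λ r → assoc xs rs u ≡ just r
  assoc-defined (x ∷ xs) (r ∷ rs) {u} u∈ e with x ≡ᵇ u in x≟u | u∈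
  ... | true | _ = r , refl
  ... | false | here refl = ⊥-elim (subst T x≟u (ℕP.≡⇒≡ᵇ x x refl))
  ... | false | there u∈xs = assoc-defined xs rs u∈xs (ℕP.suc-injective e)

  does-lem⇒ : ∀ {A : Set} → does (lem {A}) ≡ true → A
  does-lem⇒ {A} e with lem {A} | e
  ... | yes a | _ = a
  ... | no _ | ()

  aggf-cong : ∀ α {T T′ : List P → Set} → (∀ x → T x ⇔ T′ x) → aggf α T ≡ aggf α T′
  aggf-cong α T⇔T′ = aggf-ext α _ _ (λ x → to (T⇔T′ x) , from (T⇔T′ x))

  does-lem-false⇒¬ : ∀ {A : Set} → does (lem {A}) ≡ false → ¬ A
  does-lem-false⇒¬ {A} e a with lem {A} | e
  ... | yes _ | ()
  ... | no ¬a | _ = ¬a a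

  justifies-cong : ∀ α r s {T T′ : List P → Set} → (∀ x → T x ⇔ T′ x) →
                   justifies α r s T → justifies α r s T′
  justifies-cong α r (bpt s) T⇔T′ = subst (λ z → relSem r z s) (aggf-cong α T⇔T′)

  pv∉map-pv : ∀ {u Xl} → u ∉ Xl → pv u ∉ map pv Xl
  pv∉map-pv u∉ pv∈ with ∈P.∈-map⁻ pv pv∈
  ... | _ , u∈ , refl = u∉ u∈

  newVs∉map-pv : ∀ {k n z} Xl → z ∈ newVs k n → z ∉ map pv Xl
  newVs∉map-pv Xl z∈ z∈pvs with newVs-∈ z∈ | ∈P.∈-map⁻ pv z∈pvs
  ... | _ , refl | _ , _ , ()

  WellScoped : Sub → Env → List ℕ → ℕ → Set
  WellScoped θ ρ Xl v = (θ v ≡ just (ρ (pv v)) × v ∉ Xl) ⊎ (θ v ≡ nothing × v ∈ Xl)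

  boundValue : Env → Bound → P
  boundValue ρ (bvar v) = ρ (pv v)
  boundValue ρ (bpt r) = r

  ⟦boundTerm⟧ : ∀ ρ y s {z} → ⟦ sT (envSub (upd ρ (nv 0) y)) (boundTerm s) ⟧ z ⇔ z ≡ boundValue ρ s
  ⟦boundTerm⟧ ρ y (bvar v) = ⟦ptTerm⟧ (ρ (pv v))
  ⟦boundTerm⟧ ρ y (bpt r) {z} = ⇔.trans (≡⇒⇔ (cong (λ t → ⟦ t ⟧ z) (sT-ptTerm _ r))) (⟦ptTerm⟧ r)

  Scoped : Sub → Env → List ℕ → BElem → Set
  Scoped θ ρ Xl (cel c) = Agree θ (envSub ρ) (varsCE c)
  Scoped θ ρ Xl (aggE α t C r s) =
    (∀ v → v ∈ varsTs (L⁺.toList t) ++ concatMap varsCE C → WellScoped θ ρ Xl v) ×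
    sBound θ s ≡ bpt (boundValue ρ s)

  sBound-cong : ∀ {σ σ′} → σ ≗ σ′ → ∀ s → sBound σ s ≡ sBound σ′ s
  sBound-cong σ≗σ′ (bvar v) rewrite σ≗σ′ v = refl
  sBound-cong σ≗σ′ (bpt _) = refl

  sBE-cong : ∀ {σ σ′} → σ ≗ σ′ → ∀ b → sBE σ b ≡ sBE σ′ b
  sBE-cong σ≗σ′ (cel c) = cong cel (sCE-cong c (λ v _ → σ≗σ′ v))
  sBE-cong σ≗σ′ (aggE α (t L⁺.∷ ts) C r s)
    rewrite sT-cong t (λ v _ → σ≗σ′ v)
          | LP.map-cong (λ u → sT-cong u (λ v _ → σ≗σ′ v)) ts
          | LP.map-cong (λ c → sCE-cong c (λ v _ → σ≗σ′ v)) C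
          | sBound-cong σ≗σ′ s = refl

  map-sBE-cong : ∀ {σ σ′} → σ ≗ σ′ → ∀ B → map (sBE σ) B ≡ map (sBE σ′) B
  map-sBE-cong σ≗σ′ = LP.map-cong (sBE-cong σ≗σ′)

  ∈-fvF-∧ˡ : ∀ {x} F G → x ∈ fvF F → x ∈ fvF (F f∧ G)
  ∈-fvF-∧ˡ F G x∈ = ∈P.∈-++⁺ˡ (∈P.∈-++⁺ˡ x∈)

  ∈-fvF-∧ʳ : ∀ {x} F G → x ∈ fvF G → x ∈ fvF (F f∧ G)
  ∈-fvF-∧ʳ F G x∈ = ∈P.∈-++⁺ˡ (∈P.∈-++⁺ʳ (fvF F) (∈P.∈-++⁺ˡ x∈))

  ∈-fvF-conjL : ∀ {x F} Fs → F ∈ Fs → x ∈ fvF F → x ∈ fvF (conjL Fs)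
  ∈-fvF-conjL (G ∷ []) (here refl) x∈ = x∈
  ∈-fvF-conjL (G ∷ Gs@(_ ∷ _)) (here refl) x∈ = ∈-fvF-∧ˡ G (conjL Gs) x∈
  ∈-fvF-conjL (G ∷ Gs@(_ ∷ _)) (there F∈) x∈ = ∈-fvF-∧ʳ G (conjL Gs) (∈-fvF-conjL Gs F∈ x∈)

  ∈-fvF-exs : ∀ {x} xs F → x ∉ xs → x ∈ fvF F → x ∈ fvF (exs xs F)
  ∈-fvF-exs [] F _ x∈ = x∈
  ∈-fvF-exs (y ∷ ys) F x∉ x∈ =
    ∈P.∈-++⁺ˡ (∈-dropVs⁺ (y ∷ []) (∈P.∈-++⁺ˡ (∈-fvF-exs ys F (x∉ ∘ there) x∈))
                         (λ { (here x≡y) → x∉ (here x≡y) }))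

  pv∈fvF-mems : ∀ {g} Xs ts → length Xs ≡ length ts → g ∈ varsTs ts → pv g ∈ fvF (conjL (mems Xs ts))
  pv∈fvF-mems Xs ts e g∈ = let F , F∈ , g∈F = go Xs ts e g∈ in ∈-fvF-conjL (mems Xs ts) F∈ g∈F
    where
    go : ∀ {g} Xs ts → length Xs ≡ length ts → g ∈ varsTs ts →
         Σ Formula λ F → F ∈ mems Xs ts × pv g ∈ fvF F
    go (X ∷ Xs) (t ∷ ts) e g∈ with ∈P.∈-++⁻ (varsT t) g∈
    ... | inj₁ g∈t = fMem (aVar X) t , here refl , there (∈P.∈-map⁺ pv g∈t)
    ... | inj₂ g∈ts = let F , F∈ , g∈F = go Xs ts (ℕP.suc-injective e) g∈ts in F , there F∈ , g∈F

  pv∈fvF-φL : ∀ {g} ts G → g ∈ varsTs ts →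
              pv g ∈ fvF (exs (newVs 0 (length ts)) (conjL (mems (newVs 0 (length ts)) ts) f∧ G))
  pv∈fvF-φL ts G g∈ = ∈-fvF-exs Xs _ (pv∉newVs 0 _ _)
    (∈-fvF-∧ˡ (conjL (mems Xs ts)) G (pv∈fvF-mems Xs ts (length-newVs 0 _) g∈))
    where Xs = newVs 0 (length ts)

  pv∈fvF-φC : ∀ {g} c → g ∈ varsCE c → pv g ∈ fvF (φC c)
  pv∈fvF-φC (lit (pos (p , ts))) g∈ = pv∈fvF-φL ts (fAtom p (map aVar (newVs 0 (length ts)))) g∈
  pv∈fvF-φC (lit (neg (p , ts))) g∈ = pv∈fvF-φL ts (f¬ (fAtom p (map aVar (newVs 0 (length ts))))) g∈
  pv∈fvF-φC (cmp r t₁ t₂) g∈ =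
    ∈-fvF-exs (nv 0 ∷ nv 1 ∷ []) (conjL cs) (λ { (here ()) ; (there (here ())) })
    ([ (λ g∈t₁ → ∈-fvF-conjL cs (here refl) (there (∈P.∈-map⁺ pv g∈t₁)))
     , (λ g∈t₂ → ∈-fvF-conjL cs (there (here refl)) (there (∈P.∈-map⁺ pv g∈t₂))) ]′
     (∈P.∈-++⁻ (varsT t₁) g∈))
    where
    cs = fMem (aVar (nv 0)) t₁ ∷ fMem (aVar (nv 1)) t₂ ∷ fCmp r (aVar (nv 0)) (aVar (nv 1)) ∷ []

  pv∈fvF-φX : ∀ {g} Xl b → g ∈ globalBE b → pv g ∈ fvF (φX Xl b)
  pv∈fvF-φX Xl (cel c) g∈ = pv∈fvF-φC c g∈
  pv∈fvF-φX Xl (aggE α t C r (bvar v)) (here refl) =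
    ∈-fvF-exs (nv 0 ∷ []) (compared f∧ fMem (aVar (nv 0)) (var v)) (λ { (here ()) })
      (∈-fvF-∧ʳ compared (fMem (aVar (nv 0)) (var v)) (there (here refl)))
    where
    Z = newVs 1 (L⁺.length t)
    compared = fCmp r (aAgg α Z (exs (map pv Xl) (conjL (mems Z (L⁺.toList t)) f∧ φCs C))) (aVar (nv 0))

  pv∈fvF-φBody : ∀ {g} Xl B → g ∈ concatMap globalBE B → pv g ∈ fvF (φBody Xl B)
  pv∈fvF-φBody Xl B g∈ = let b , b∈ , g∈b = find (∈P.∈-concatMap⁻ globalBE g∈) in
    ∈-fvF-conjL (map (φX Xl) B) (∈P.∈-map⁺ (φX Xl) b∈) (pv∈fvF-φX Xl b g∈b)

  ∈⇒∈ᵇ : ∀ {v vs} → v ∈ vs → (v ∈ᵇ vs) ≡ true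
  ∈⇒∈ᵇ {v} v∈ = to T-≡ (any⁺ _ (Any.map (λ { refl → ℕP.≡⇒≡ᵇ v v refl }) v∈))

  ∈ᵇ⇒∈ : ∀ {v} vs → (v ∈ᵇ vs) ≡ true → v ∈ vs
  ∈ᵇ⇒∈ vs e = Any.map (λ t → sym (ℕP.≡ᵇ⇒≡ _ _ t)) (any⁻ _ vs (from T-≡ e))

  instSub : Rule → (ℕ → P) → Sub
  instSub R ρg v = if v ∈ᵇ globalVars R then just (ρg v) else nothing

  instSub-global : ∀ R ρg {v} → v ∈ globalVars R → instSub R ρg v ≡ just (ρg v)
  instSub-global R ρg v∈ rewrite ∈⇒∈ᵇ v∈ = refl

  instSub-cong : ∀ R {ρg ρg′} → (∀ v → v ∈ globalVars R → ρg v ≡ ρg′ v) → instSub R ρg ≗ instSub R ρg′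
  instSub-cong R agree v with v ∈ᵇ globalVars R in e
  ... | true = cong just (agree v (∈ᵇ⇒∈ (globalVars R) e))
  ... | false = refl

  global-head : ∀ h B {v} → v ∈ varsH h → v ∈ globalVars (h ⟵ B)
  global-head h B v∈ = ∈-deduplicateᵇ⁺ (∈P.∈-++⁺ˡ v∈)

  global-body : ∀ h B {b v} → b ∈ B → v ∈ globalBE b → v ∈ globalVars (h ⟵ B)
  global-body h B b∈ v∈ = ∈-deduplicateᵇ⁺ (∈P.∈-++⁺ʳ (varsH h) (∈-concatMap globalBE b∈ v∈))

  ∈-localVars⁻ : ∀ R {v} → v ∈ localVars R → (v ∈ᵇ globalVars R) ≡ false
  ∈-localVars⁻ R v∈ = to T-not-≡ (proj₂ (∈P.∈-filter⁻ (λ x → T? (not (x ∈ᵇ globalVars R)))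
    {xs = deduplicateᵇ _≡ᵇ_ (varsH (head R) ++ concatMap varsBE (body R))} v∈))

  ∈-localVars⁺ : ∀ h B {b v} → b ∈ B → v ∈ varsBE b → (v ∈ᵇ globalVars (h ⟵ B)) ≡ false →
                 v ∈ localVars (h ⟵ B)
  ∈-localVars⁺ h B b∈ v∈ e = ∈P.∈-filter⁺ _
    (∈-deduplicateᵇ⁺ (∈P.∈-++⁺ʳ (varsH h) (∈-concatMap varsBE b∈ v∈))) (from T-not-≡ e)

  scoped-instance : ∀ h B ρ {b} → b ∈ B → Scoped (instSub (h ⟵ B) (ρ ∘ pv)) ρ (localVars (h ⟵ B)) b
  scoped-instance h B ρ {cel c} b∈ v v∈ = instSub-global (h ⟵ B) (ρ ∘ pv) (global-body h B b∈ v∈)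
  scoped-instance h B ρ {aggE α t C r s} b∈ = wellScoped , bound s refl
    where
    R = h ⟵ B
    wellScoped : ∀ v → v ∈ varsTs (L⁺.toList t) ++ concatMap varsCE C →
                 WellScoped (instSub R (ρ ∘ pv)) ρ (localVars R) v
    wellScoped v v∈ with v ∈ᵇ globalVars R in e
    ... | true = inj₁ (refl , λ v∈L → case trans (sym (∈-localVars⁻ R v∈L)) e of λ ())
    ... | false = inj₂ (refl , ∈-localVars⁺ h B b∈ v∈agg e)
      where v∈agg = ∈-deduplicateᵇ⁺ (∈-++-map {xs = varsTs (L⁺.toList t)} id ∈P.∈-++⁺ˡ v∈)
    bound : ∀ s′ → s′ ≡ s → sBound (instSub R (ρ ∘ pv)) s′ ≡ bpt (boundValue ρ s′)
    bound (bvar v) refl rewrite instSub-global R (ρ ∘ pv) (global-body h B b∈ (here refl)) = refl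
    bound (bpt _) _ = refl

-- Agreement of φ and τ, and the completion as supportedness

module Correspondence (S : Signature) (lem : ExcludedMiddle 0ℓ) (I : Lang.Interp S lem) where
  open Signature S
  open Lang S lem renaming (sym to symbol)
  open Syntax S lem
  open EquationalReasoning {k = Kind.equivalence}

  sat-∧ : ∀ ρ F G → sat I ρ (F f∧ G) ⇔ (sat I ρ F × sat I ρ G)
  sat-∧ ρ F G = mk⇔ (λ h → dne (λ ¬f → h (λ f _ → ¬f f)) , dne (λ ¬g → h (λ _ g → ¬g g)))
                    (λ (f , g) h → h f g)

  sat-∨ : ∀ ρ F G → sat I ρ (F f∨ G) ⇔ (sat I ρ F ⊎ sat I ρ G)
  sat-∨ ρ F G = mk⇔ split [ (λ f ¬f → ⊥-elim (¬f f)) , (λ g _ → g) ]′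
    where
    split : sat I ρ (F f∨ G) → sat I ρ F ⊎ sat I ρ G
    split h with lem {sat I ρ F}
    ... | yes f = inj₁ f
    ... | no ¬f = inj₂ (h ¬f)

  sat-conjL : ∀ ρ Fs → sat I ρ (conjL Fs) ⇔ All (sat I ρ) Fs
  sat-conjL ρ Fs = mk⇔ (⇒All Fs) (All⇒ Fs)
    where
    ⇒All : ∀ Fs → sat I ρ (conjL Fs) → All (sat I ρ) Fs
    ⇒All [] _ = []
    ⇒All (F ∷ []) f = f ∷ []
    ⇒All (F ∷ Gs@(_ ∷ _)) h = let f , gs = to (sat-∧ ρ F (conjL Gs)) h in f ∷ ⇒All Gs gs
    All⇒ : ∀ Fs → All (sat I ρ) Fs → sat I ρ (conjL Fs)
    All⇒ [] _ b = b
    All⇒ (F ∷ []) (f ∷ []) = f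
    All⇒ (F ∷ Gs@(_ ∷ _)) (f ∷ gs) = from (sat-∧ ρ F (conjL Gs)) (f , All⇒ Gs gs)

  sat-disjL : ∀ ρ Fs → sat I ρ (disjL Fs) ⇔ Any (sat I ρ) Fs
  sat-disjL ρ Fs = mk⇔ (⇒Any Fs) (Any⇒ Fs)
    where
    ⇒Any : ∀ Fs → sat I ρ (disjL Fs) → Any (sat I ρ) Fs
    ⇒Any (F ∷ []) f = here f
    ⇒Any (F ∷ Gs@(_ ∷ _)) h = [ here , there ∘ ⇒Any Gs ]′ (to (sat-∨ ρ F (disjL Gs)) h)
    Any⇒ : ∀ Fs → Any (sat I ρ) Fs → sat I ρ (disjL Fs)
    Any⇒ (F ∷ []) (here f) = f
    Any⇒ (F ∷ Gs@(_ ∷ _)) (here f) = from (sat-∨ ρ F (disjL Gs)) (inj₁ f)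
    Any⇒ (F ∷ Gs@(_ ∷ _)) (there gs) = from (sat-∨ ρ F (disjL Gs)) (inj₂ (Any⇒ Gs gs))

  sat-∃ : ∀ ρ x F → sat I ρ (fEx x F) ⇔ Σ P (λ r → sat I (upd ρ x r) F)
  sat-∃ ρ x F = mk⇔ (λ h → dne (λ ¬∃ → h (λ r f → ¬∃ (r , f)))) (λ (r , f) h → h r f)

  sat-exs : ∀ ρ xs F → sat I ρ (exs xs F) ⇔
            Σ (List P) (λ rs → length rs ≡ length xs × sat I (extend ρ xs rs) F)
  sat-exs ρ [] F = mk⇔ (λ f → [] , refl , f) (λ { ([] , _ , f) → f })
  sat-exs ρ (x ∷ xs) F = mk⇔
    (λ h → let r , h′ = to (sat-∃ ρ x (exs xs F)) h
               rs , e , f = to (sat-exs (upd ρ x r) xs F) h′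
           in r ∷ rs , cong suc e , f)
    (λ { (r ∷ rs , e , f) → from (sat-∃ ρ x (exs xs F))
           (r , from (sat-exs (upd ρ x r) xs F) (rs , ℕP.suc-injective e , f)) })

  sat-alls : ∀ ρ xs F → sat I ρ (alls xs F) ⇔
             (∀ rs → length rs ≡ length xs → sat I (extend ρ xs rs) F)
  sat-alls ρ [] F = mk⇔ (λ { f [] _ → f }) (λ h → h [] refl)
  sat-alls ρ (x ∷ xs) F = mk⇔
    (λ { h (r ∷ rs) e → to (sat-alls (upd ρ x r) xs F) (h r) rs (ℕP.suc-injective e) })
    (λ h r → from (sat-alls (upd ρ x r) xs F) (λ rs e → h (r ∷ rs) (cong suc e)))

  evalAs-aVars : ∀ ρ xs → evalAs I ρ (map aVar xs) ≡ map ρ xs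
  evalAs-aVars ρ [] = refl
  evalAs-aVars ρ (x ∷ xs) = cong (ρ x ∷_) (evalAs-aVars ρ xs)

  sat-mems : ∀ ρ xs ts → length xs ≡ length ts →
             All (sat I ρ) (mems xs ts) ⇔ ⟦ sTs (envSub ρ) ts ⟧ᴸ (map ρ xs)
  sat-mems ρ [] [] e = mk⇔ (λ _ → tt) (λ _ → [])
  sat-mems ρ (x ∷ xs) (t ∷ ts) e = mk⇔ (λ { (m ∷ ms) → m , to ih ms }) (λ (m , ms) → m ∷ from ih ms)
    where ih = sat-mems ρ xs ts (ℕP.suc-injective e)

  evalAs-newVs : ∀ ρ k n rs → length rs ≡ n →
                 evalAs I (extend ρ (newVs k n) rs) (map aVar (newVs k n)) ≡ rs
  evalAs-newVs ρ k n rs e = trans (evalAs-aVars _ (newVs k n))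
    (map-extend ρ (newVs k n) rs (unique-newVs k n) (trans e (sym (length-newVs k n))))

  sat-atom-newVs : ∀ ρ p k n rs → length rs ≡ n →
                   sat I (extend ρ (newVs k n) rs) (fAtom p (map aVar (newVs k n))) ⇔ I (p , rs)
  sat-atom-newVs ρ p k n rs e = ≡⇒⇔ (cong (λ z → I (p , z)) (evalAs-newVs ρ k n rs e))

  sat-∃∈ : ∀ ρ k ts G (Q : List P → Set) →
           (∀ rs → length rs ≡ length ts → sat I (extend ρ (newVs k (length ts)) rs) G ⇔ Q rs) →
           sat I ρ (exs (newVs k (length ts)) (conjL (mems (newVs k (length ts)) ts) f∧ G)) ⇔
           Σ (List P) (λ rs → ⟦ sTs (envSub ρ) ts ⟧ᴸ rs × Q rs)
  sat-∃∈ ρ k ts G Q G⇔Q = ⇔.trans (sat-exs ρ Xs _) (mk⇔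
      (λ (rs , e , h) → let m , g = to (sat-∧ ρ[ rs ] (conjL (mems Xs ts)) G) h
                            e′ = trans e ∣Xs∣
                        in rs , to (values rs e′) (to (sat-conjL ρ[ rs ] (mems Xs ts)) m) ,
                           to (G⇔Q rs e′) g)
      (λ (rs , m , q) → let e′ = ⟦sTs⟧ᴸ-length (envSub ρ) ts m in
        rs , trans e′ (sym ∣Xs∣) , from (sat-∧ ρ[ rs ] (conjL (mems Xs ts)) G)
          (from (sat-conjL ρ[ rs ] (mems Xs ts)) (from (values rs e′) m) , from (G⇔Q rs e′) q)))
    where
    Xs = newVs k (length ts)
    ∣Xs∣ : length Xs ≡ length ts
    ∣Xs∣ = length-newVs k (length ts)
    ρ[_] : List P → Env
    ρ[ rs ] = extend ρ Xs rs
    values : ∀ rs → length rs ≡ length ts →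
             All (sat I ρ[ rs ]) (mems Xs ts) ⇔ ⟦ sTs (envSub ρ) ts ⟧ᴸ rs
    values rs e = ⇔.trans (sat-mems ρ[ rs ] Xs ts ∣Xs∣) (≡⇒⇔ (cong₂ ⟦_⟧ᴸ
      (sTs-cong ts (λ v _ → cong just (extend-∉ ρ Xs rs (pv∉newVs k (length ts) v))))
      (map-extend ρ Xs rs (unique-newVs k (length ts)) (trans e (sym ∣Xs∣)))))

  ⊨-⋀-lookup : ∀ {A : Set} (f : A → IF) xs →
               I ⊨ ⋀ (Fin (length xs)) (f ∘ lookup xs) ⇔ All (λ x → I ⊨ f x) xs
  ⊨-⋀-lookup f xs = mk⇔ (⇒All xs) (All⇒ xs)
    where
    ⇒All : ∀ xs → I ⊨ ⋀ (Fin (length xs)) (f ∘ lookup xs) → All (λ x → I ⊨ f x) xs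
    ⇒All [] _ = []
    ⇒All (x ∷ xs) h = h Fin.zero ∷ ⇒All xs (h ∘ Fin.suc)
    All⇒ : ∀ xs → All (λ x → I ⊨ f x) xs → I ⊨ ⋀ (Fin (length xs)) (f ∘ lookup xs)
    All⇒ (x ∷ xs) (fx ∷ _) Fin.zero = fx
    All⇒ (x ∷ xs) (_ ∷ fxs) (Fin.suc i) = All⇒ xs fxs i

  ⊨-⋁⟦⟧ : ∀ ts (F : List P → IF) →
          I ⊨ ⋁ (Σ (List P) λ rs → ⟦ ts ⟧ᴸ rs) (F ∘ proj₁) ⇔ Σ (List P) (λ rs → ⟦ ts ⟧ᴸ rs × I ⊨ F rs)
  ⊨-⋁⟦⟧ ts F = mk⇔ (λ ((rs , m) , f) → rs , m , f) (λ (rs , m , f) → (rs , m) , f)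

  ⊨-τC-cmp : ∀ r t₁ t₂ → I ⊨ τC (cmp r t₁ t₂) ⇔
             Σ P (λ r₁ → Σ P λ r₂ → ⟦ t₁ ⟧ r₁ × ⟦ t₂ ⟧ r₂ × relSem r r₁ r₂)
  ⊨-τC-cmp r t₁ t₂ with lem {Σ P (λ r₁ → Σ P λ r₂ → ⟦ t₁ ⟧ r₁ × ⟦ t₂ ⟧ r₂ × relSem r r₁ r₂)}
  ... | yes w = mk⇔ (λ _ → w) (λ _ z → z)
  ... | no ¬w = mk⇔ (λ ()) (λ w → ⊥-elim (¬w w))

  φC⇔τC : ∀ ρ θ c → Agree θ (envSub ρ) (varsCE c) → sat I ρ (φC c) ⇔ I ⊨ τC (sCE θ c)
  φC⇔τC ρ θ (lit (pos (p , ts))) a rewrite sTs-cong ts a =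
    ⇔.trans (sat-∃∈ ρ 0 ts _ (λ rs → I (p , rs)) (λ rs e → sat-atom-newVs ρ p 0 _ rs e))
            (⇔.sym (⊨-⋁⟦⟧ (sTs (envSub ρ) ts) (λ rs → atm (p , rs))))
  φC⇔τC ρ θ (lit (neg (p , ts))) a rewrite sTs-cong ts a =
    ⇔.trans (sat-∃∈ ρ 0 ts _ (λ rs → ¬ I (p , rs))
                     (λ rs e → mk⇔ (λ ¬A → ¬A ∘ from (sat-atom-newVs ρ p 0 _ rs e))
                                   (λ ¬A → ¬A ∘ to (sat-atom-newVs ρ p 0 _ rs e))))
            (⇔.sym (⊨-⋁⟦⟧ (sTs (envSub ρ) ts) (λ rs → ¬I (atm (p , rs)))))
  φC⇔τC ρ θ (cmp r t₁ t₂) a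
    rewrite sT-cong t₁ (Agree-++⁻ˡ (varsT t₁) a) | sT-cong t₂ (Agree-++⁻ʳ (varsT t₁) a) =
    ⇔.trans (sat-exs ρ (nv 0 ∷ nv 1 ∷ []) (conjL cs))
      (⇔.trans (mk⇔ (λ { (r₁ ∷ r₂ ∷ [] , _ , h) → unpack r₁ r₂ (to (sat-conjL _ cs) h) })
                    (λ (r₁ , r₂ , m₁ , m₂ , c) →
                       r₁ ∷ r₂ ∷ [] , refl ,
                       from (sat-conjL (upd (upd ρ (nv 0) r₁) (nv 1) r₂) cs) (m₁ ∷ m₂ ∷ c ∷ [])))
               (⇔.sym (⊨-τC-cmp r _ _)))
    where
    cs : List Formula
    cs = fMem (aVar (nv 0)) t₁ ∷ fMem (aVar (nv 1)) t₂ ∷ fCmp r (aVar (nv 0)) (aVar (nv 1)) ∷ []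
    unpack : ∀ r₁ r₂ → All (sat I (upd (upd ρ (nv 0) r₁) (nv 1) r₂)) cs →
             Σ P (λ r₁ → Σ P λ r₂ → ⟦ sT (envSub ρ) t₁ ⟧ r₁ × ⟦ sT (envSub ρ) t₂ ⟧ r₂ × relSem r r₁ r₂)
    unpack r₁ r₂ (m₁ ∷ m₂ ∷ c ∷ []) = r₁ , r₂ , m₁ , m₂ , c

  φCs⇔τCs : ∀ ρ θ C → Agree θ (envSub ρ) (concatMap varsCE C) →
            sat I ρ (φCs C) ⇔ I ⊨ τCs (map (sCE θ) C)
  φCs⇔τCs ρ θ C a = begin
    sat I ρ (φCs C)                         ∼⟨ sat-conjL ρ (map φC C) ⟩
    All (sat I ρ) (map φC C)                ∼⟨ All-map φC C ⟩
    All (sat I ρ ∘ φC) C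
      ∼⟨ All-⇔ C (λ {c} c∈ → φC⇔τC ρ θ c (Agree-concatMap varsCE c∈ a)) ⟩
    All ((I ⊨_) ∘ τC ∘ sCE θ) C             ∼⟨ ⇔.sym (All-map (sCE θ) C) ⟩
    All ((I ⊨_) ∘ τC) (map (sCE θ) C)       ∼⟨ ⇔.sym (⊨-⋀-lookup τC (map (sCE θ) C)) ⟩
    I ⊨ τCs (map (sCE θ) C)                 ∎

  -- The local definitions of τB (aggE α t C r s), so that they unfold to the same terms.
  module Aggregate (α : Agg) (t : L⁺.List⁺ Term) (C : List CElem) (r : RelSym) (s : Bound) where
    X = varsAgg t C s
    k = length X

    subᵛ : Vec P k → Sub
    subᵛ v = assoc X (V.toList v)

    conditions : Vec P k → List CElem
    conditions v = map (sCE (subᵛ v)) C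

    ⟦_⟧Δ : (Vec P k → Bool) → List P → Set
    ⟦ Δ ⟧Δ rs = Σ (Vec P k) λ v → Δ v ≡ true × ⟦ sTs (subᵛ v) (L⁺.toList t) ⟧ᴸ rs

    Δᴵ : Vec P k → Bool
    Δᴵ v = does (lem {I ⊨ τCs (conditions v)})

    -- If Δᴵ does not justify the expression, its own conjunct in τ fails in I; any other Δ differs
    -- from Δᴵ on some tuple, which makes its conjunct true.
    ⊨-τB⇔justifies : I ⊨ τB (aggE α t C r s) ⇔ justifies α r s ⟦ Δᴵ ⟧Δ
    ⊨-τB⇔justifies = mk⇔ ⇒justifies justifies⇒
      where
      ⇒justifies : I ⊨ τB (aggE α t C r s) → justifies α r s ⟦ Δᴵ ⟧Δ
      ⇒justifies h = dne λ ¬j →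
        let (v , Δᴵv≡false) , c = h (Δᴵ , ¬j) (λ (v , e) → does-lem⇒ e)
        in does-lem-false⇒¬ Δᴵv≡false c
      justifies⇒ : justifies α r s ⟦ Δᴵ ⟧Δ → I ⊨ τB (aggE α t C r s)
      justifies⇒ j (Δ , ¬jΔ) Δ-holds with lem {Σ (Vec P k) λ v → Δ v ≡ false × I ⊨ τCs (conditions v)}
      ... | yes (v , e , c) = (v , e) , c
      ... | no ¬outside = ⊥-elim (¬jΔ (justifies-cong α r s Δᴵ⇔Δ j))
        where
        Δᴵ⇒Δ : ∀ v → Δᴵ v ≡ true → Δ v ≡ true
        Δᴵ⇒Δ v e with Δ v in Δv
        ... | true = refl
        ... | false = ⊥-elim (¬outside (v , Δv , does-lem⇒ e))
        Δᴵ⇔Δ : ∀ rs → ⟦ Δᴵ ⟧Δ rs ⇔ ⟦ Δ ⟧Δ rs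
        Δᴵ⇔Δ rs = mk⇔ (λ (v , e , m) → v , Δᴵ⇒Δ v e , m)
                      (λ (v , e , m) → v , dec-true lem (Δ-holds (v , e)) , m)

  module AggregateSet (ρ : Env) (θ : Sub) (Xl : List ℕ) (α : Agg) (t : L⁺.List⁺ Term)
                      (C : List CElem) (r : RelSym) (s : Bound) (y : P)
                      (scoped : ∀ v → v ∈ varsTs (L⁺.toList t) ++ concatMap varsCE C →
                                      WellScoped θ ρ Xl v) where
    open Aggregate α (L⁺.map (sT θ) t) (map (sCE θ) C) r (sBound θ s)

    ts = L⁺.toList t
    Z = newVs 1 (L⁺.length t)
    Vars = varsTs ts ++ concatMap varsCE C
    Inner = conjL (mems Z ts) f∧ φCs C
    ρʸ = upd ρ (nv 0) y

    ∣Z∣ : length Z ≡ length ts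
    ∣Z∣ = length-newVs 1 (L⁺.length t)

    ts-θ : L⁺.toList (L⁺.map (sT θ) t) ≡ sTs θ ts
    ts-θ = map-sT θ ts

    local∈X : ∀ {u} → u ∈ Vars → θ u ≡ nothing → u ∈ X
    local∈X {u} u∈ e = ∈-deduplicateᵇ⁺ (subst (λ ts′ → u ∈ varsTs ts′ ++ rest) (sym ts-θ)
      (∈-++-map (varsTs-sTs θ ts e) (∈P.∈-++⁺ˡ ∘ varsCEs-sCEs θ C e) u∈))
      where rest = concatMap varsCE (map (sCE θ) C) ++ varsBound (sBound θ s)

    ρ[_,_] : List P → List P → Env
    ρ[ rs , vals ] = extend (extend ρʸ Z rs) (map pv Xl) vals

    map-ρ[]-Z : ∀ rs vals → length rs ≡ length Z → map ρ[ rs , vals ] Z ≡ rs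
    map-ρ[]-Z rs vals e = trans
      (LP.map-cong-local (All.tabulate (λ z∈ → extend-∉ _ (map pv Xl) vals (newVs∉map-pv Xl z∈))))
      (map-extend ρʸ Z rs (unique-newVs 1 _) e)

    θ▹ : Vec P k → Sub
    θ▹ v = θ ▹ subᵛ v

    agree : ∀ rs vals v → (∀ {u} → u ∈ X → u ∈ Xl → subᵛ v u ≡ just (ρ[ rs , vals ] (pv u))) →
            Agree (θ▹ v) (envSub ρ[ rs , vals ]) Vars
    agree rs vals v locals u u∈ with scoped u u∈
    ... | inj₁ (θu , u∉Xl) rewrite θu = cong just (sym (trans
            (extend-∉ _ (map pv Xl) vals (pv∉map-pv u∉Xl)) (extend-∉ ρʸ Z rs (pv∉newVs 1 _ _))))
    ... | inj₂ (θu , u∈Xl) rewrite θu = locals (local∈X u∈ θu) u∈Xl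

    inner⇔ : ∀ rs vals v → length rs ≡ length Z → Agree (θ▹ v) (envSub ρ[ rs , vals ]) Vars →
             sat I ρ[ rs , vals ] Inner ⇔
             (⟦ sTs (subᵛ v) (L⁺.toList (L⁺.map (sT θ) t)) ⟧ᴸ rs × I ⊨ τCs (conditions v))
    inner⇔ rs vals v e a = ⇔.trans (sat-∧ ρ′ (conjL (mems Z ts)) (φCs C)) (members ×-⇔ conds)
      where
      ρ′ = ρ[ rs , vals ]
      terms : sTs (subᵛ v) (L⁺.toList (L⁺.map (sT θ) t)) ≡ sTs (envSub ρ′) ts
      terms = trans (cong (sTs (subᵛ v)) ts-θ)
                    (trans (sTs-▹ θ (subᵛ v) ts) (sTs-cong ts (Agree-++⁻ˡ (varsTs ts) a)))
      members : sat I ρ′ (conjL (mems Z ts)) ⇔ ⟦ sTs (subᵛ v) (L⁺.toList (L⁺.map (sT θ) t)) ⟧ᴸ rs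
      members = begin
        sat I ρ′ (conjL (mems Z ts))                        ∼⟨ sat-conjL ρ′ (mems Z ts) ⟩
        All (sat I ρ′) (mems Z ts)                          ∼⟨ sat-mems ρ′ Z ts ∣Z∣ ⟩
        ⟦ sTs (envSub ρ′) ts ⟧ᴸ (map ρ′ Z)
          ≡⟨ cong₂ ⟦_⟧ᴸ (sym terms) (map-ρ[]-Z rs vals e) ⟩
        ⟦ sTs (subᵛ v) (L⁺.toList (L⁺.map (sT θ) t)) ⟧ᴸ rs  ∎
      conds : sat I ρ′ (φCs C) ⇔ I ⊨ τCs (conditions v)
      conds = ⇔.trans (φCs⇔τCs ρ′ (θ▹ v) C (Agree-++⁻ʳ (varsTs ts) a))
                      (≡⇒⇔ (cong (λ C′ → I ⊨ τCs C′) (sym (map-sCE-▹ θ (subᵛ v) C))))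

    Member : List P → Set
    Member rs = length rs ≡ length Z × sat I (extend ρʸ Z rs) (exs (map pv Xl) Inner)

    member⇒Δᴵ : ∀ rs → Member rs → ⟦ Δᴵ ⟧Δ rs
    member⇒Δᴵ rs (e , h) with to (sat-exs (extend ρʸ Z rs) (map pv Xl) Inner) h
    ... | vals , _ , inner = v , dec-true lem (proj₂ m×c) , proj₁ m×c
      where
      g : ℕ → P
      g x = ρ[ rs , vals ] (pv x)
      v : Vec P k
      v = V.map g (V.fromList X)
      locals : ∀ {u} → u ∈ X → u ∈ Xl → subᵛ v u ≡ just (g u)
      locals u∈X _ = trans (cong (λ z → assoc X z _) (trans (VP.toList-map g (V.fromList X))
                                                               (cong (map g) (VP.toList∘fromList X))))
                           (assoc-map g X u∈X)
      m×c = to (inner⇔ rs vals v e (agree rs vals v locals)) inner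

    Δᴵ⇒member : ∀ rs → ⟦ Δᴵ ⟧Δ rs → Member rs
    Δᴵ⇒member rs (v , e , m) = ∣rs∣ , from (sat-exs (extend ρʸ Z rs) (map pv Xl) Inner)
        (vals , LP.length-map w (map pv Xl) ,
         from (inner⇔ rs vals v ∣rs∣ (agree rs vals v locals)) (m , does-lem⇒ e))
      where
      ∣rs∣ : length rs ≡ length Z
      ∣rs∣ = trans (⟦sTs⟧ᴸ-length (subᵛ v) (L⁺.toList (L⁺.map (sT θ) t)) m)
                   (trans (cong length ts-θ) (trans (length-sTs θ ts) (sym ∣Z∣)))
      w : FVar → P
      w (pv x) = maybe id pinf (subᵛ v x)
      w (nv _) = pinf   -- only read on the local variables, where subᵛ v is defined
      vals = map w (map pv Xl)
      locals : ∀ {u} → u ∈ X → u ∈ Xl → subᵛ v u ≡ just (ρ[ rs , vals ] (pv u))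
      locals {u} u∈X u∈Xl with assoc-defined X (V.toList v) u∈X (VP.length-toList v)
      ... | r₀ , sub≡ = trans sub≡ (cong just (sym (trans
              (extend-map-∈ (extend ρʸ Z rs) w (map pv Xl) (∈P.∈-map⁺ pv u∈Xl))
              (cong (maybe id pinf) sub≡))))

    -- The values of the local variables Xl in a witness for rs form the tuple v with rs ∈ [t^X_v].
    member⇔Δᴵ : ∀ rs → Member rs ⇔ ⟦ Δᴵ ⟧Δ rs
    member⇔Δᴵ rs = mk⇔ (member⇒Δᴵ rs) (Δᴵ⇒member rs)

  φX-aggregate⇔τB : ∀ ρ θ Xl α t C r s →
                    (∀ v → v ∈ varsTs (L⁺.toList t) ++ concatMap varsCE C → WellScoped θ ρ Xl v) →
                    sBound θ s ≡ bpt (boundValue ρ s) →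
                    sat I ρ (φX Xl (aggE α t C r s)) ⇔ I ⊨ τB (sBE θ (aggE α t C r s))
  φX-aggregate⇔τB ρ θ Xl α t C r s scoped θs = ⇔.trans
    (mk⇔ (λ h → compares (to (sat-exs ρ (nv 0 ∷ []) formula) h))
         (λ j → from (sat-exs ρ (nv 0 ∷ []) formula) (bound ∷ [] , refl ,
                  from (sat-∧ (upd ρ (nv 0) bound) compared member)
                       (subst (λ a → relSem r a bound) (sym (value≡ bound)) j ,
                        from (⟦boundTerm⟧ ρ bound s) refl))))
    (⇔.trans (≡⇒⇔ (cong (λ s′ → justifies α r s′ ⟦ Δᴵ ⟧Δ) (sym θs))) (⇔.sym ⊨-τB⇔justifies))
    where
    open Aggregate α (L⁺.map (sT θ) t) (map (sCE θ) C) r (sBound θ s)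
    Z = newVs 1 (L⁺.length t)
    compared member formula : Formula
    compared = fCmp r (aAgg α Z (exs (map pv Xl) (conjL (mems Z (L⁺.toList t)) f∧ φCs C))) (aVar (nv 0))
    member = fMem (aVar (nv 0)) (boundTerm s)
    formula = compared f∧ member
    bound = boundValue ρ s
    value≡ : ∀ y → aggf α (AggregateSet.Member ρ θ Xl α t C r s y scoped) ≡ aggf α ⟦ Δᴵ ⟧Δ
    value≡ y = aggf-cong α (AggregateSet.member⇔Δᴵ ρ θ Xl α t C r s y scoped)
    compares : Σ (List P) (λ ys → length ys ≡ 1 × sat I (extend ρ (nv 0 ∷ []) ys) formula) →
               relSem r (aggf α ⟦ Δᴵ ⟧Δ) bound
    compares (y ∷ [] , _ , h) =
      let c , m = to (sat-∧ (upd ρ (nv 0) y) compared member) h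
      in subst (relSem r (aggf α ⟦ Δᴵ ⟧Δ)) (to (⟦boundTerm⟧ ρ y s) m)
               (subst (λ a → relSem r a y) (value≡ y) c)

  φX⇔τB : ∀ ρ θ Xl b → Scoped θ ρ Xl b → sat I ρ (φX Xl b) ⇔ I ⊨ τB (sBE θ b)
  φX⇔τB ρ θ Xl (cel c) a = φC⇔τC ρ θ c a
  φX⇔τB ρ θ Xl (aggE α t C r s) (scoped , θs) = φX-aggregate⇔τB ρ θ Xl α t C r s scoped θs

  φBody⇔τBody : ∀ ρ θ Xl B → (∀ {b} → b ∈ B → Scoped θ ρ Xl b) →
                sat I ρ (φBody Xl B) ⇔ I ⊨ τBody (map (sBE θ) B)
  φBody⇔τBody ρ θ Xl B scoped = begin
    sat I ρ (φBody Xl B)                    ∼⟨ sat-conjL ρ (map (φX Xl) B) ⟩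
    All (sat I ρ) (map (φX Xl) B)           ∼⟨ All-map (φX Xl) B ⟩
    All (sat I ρ ∘ φX Xl) B                 ∼⟨ All-⇔ B (λ {b} b∈ → φX⇔τB ρ θ Xl b (scoped b∈)) ⟩
    All ((I ⊨_) ∘ τB ∘ sBE θ) B             ∼⟨ ⇔.sym (All-map (sBE θ) B) ⟩
    All ((I ⊨_) ∘ τB) (map (sBE θ) B)       ∼⟨ ⇔.sym (⊨-⋀-lookup τB (map (sBE θ) B)) ⟩
    I ⊨ τBody (map (sBE θ) B)               ∎

  module ExistentialClosure (n : ℕ) (F : Formula) (G : List ℕ) (G⊆fv : ∀ {g} → g ∈ G → pv g ∈ fvF F)
                            (Q : (ℕ → P) → List P → Set)
                            (Q-cong : ∀ {ρg ρg′ rs} → (∀ v → v ∈ G → ρg v ≡ ρg′ v) → Q ρg rs → Q ρg′ rs)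
                            (F⇔Q : ∀ ρ → sat I ρ F ⇔ Q (ρ ∘ pv) (map ρ (newVs 0 n))) where
    V = newVs 0 n
    U = dropVs V (fvF F)

    map-extend-V : ∀ ρ₀ rs us → length rs ≡ n → map (extend (extend ρ₀ V rs) U us) V ≡ rs
    map-extend-V ρ₀ rs us e = trans
      (LP.map-cong-local (All.tabulate λ y∈V →
         extend-∉ _ U us (λ y∈U → proj₂ (∈-dropVs⁻ V {fvF F} y∈U) y∈V)))
      (map-extend ρ₀ V rs (unique-newVs 0 n) (trans e (sym (length-newVs 0 n))))

    sat-∃U⇔ : ∀ ρ₀ rs → length rs ≡ n → sat I (extend ρ₀ V rs) (exs U F) ⇔ Σ (ℕ → P) (λ ρg → Q ρg rs)
    sat-∃U⇔ ρ₀ rs e = ⇔.trans (sat-exs (extend ρ₀ V rs) U F) (mk⇔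
      (λ (us , _ , f) → _ , subst (Q _) (map-extend-V ρ₀ rs us e) (to (F⇔Q _) f))
      (λ (ρg , q) → let w = globalEnv ρg ; ρ′ = extend (extend ρ₀ V rs) U (map w U) in
         map w U , LP.length-map w U ,
         from (F⇔Q ρ′) (subst (Q _) (sym (map-extend-V ρ₀ rs (map w U) e))
           (Q-cong (λ g g∈ → sym (extend-map-∈ (extend ρ₀ V rs) w U
                                    (∈-dropVs⁺ V (G⊆fv g∈) (pv∉newVs 0 n g)))) q))))

  Fires : Rule → List Term → (ℕ → P) → List P → Set
  Fires R ts ρg rs = ⟦ sTs (instSub R ρg) ts ⟧ᴸ rs × I ⊨ τBody (map (sBE (instSub R ρg)) (body R))

  Supports : Rule → Sym → List P → Set
  Supports R@(basic (q , ts) ⟵ B) p rs = q ≡ p × Σ (ℕ → P) (λ ρg → Fires R ts ρg rs)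
  Supports R@(choice (q , ts) ⟵ B) p rs = q ≡ p × Σ (ℕ → P) (λ ρg → Fires R ts ρg rs × I (p , rs))
  Supports (constraint ⟵ B) p rs = ⊥

  module RuleDisjunct (h : Head) (ts : List Term) (h≡ts : varsH h ≡ varsTs ts) (B : List BElem)
                      (n : ℕ) (∣ts∣ : length ts ≡ n) where
    R = h ⟵ B
    V = newVs 0 n
    F = conjL (mems V ts) f∧ φBody (localVars R) B

    ∣V∣ : length V ≡ length ts
    ∣V∣ = trans (length-newVs 0 n) (sym ∣ts∣)

    F⇔Fires : ∀ ρ → sat I ρ F ⇔ Fires R ts (ρ ∘ pv) (map ρ V)
    F⇔Fires ρ = ⇔.trans (sat-∧ ρ (conjL (mems V ts)) (φBody (localVars R) B))
      (⇔.trans (sat-conjL ρ (mems V ts))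
               (⇔.trans (sat-mems ρ V ts ∣V∣) (≡⇒⇔ (cong (λ z → ⟦ z ⟧ᴸ (map ρ V)) head≡))) ×-⇔
       φBody⇔τBody ρ _ (localVars R) B (scoped-instance h B ρ))
      where
      head≡ : sTs (envSub ρ) ts ≡ sTs (instSub R (ρ ∘ pv)) ts
      head≡ = sTs-cong ts λ v v∈ →
        sym (instSub-global R (ρ ∘ pv) (global-head h B (subst (v ∈_) (sym h≡ts) v∈)))

    Fires-cong : ∀ {ρg ρg′ rs} → (∀ v → v ∈ globalVars R → ρg v ≡ ρg′ v) →
                 Fires R ts ρg rs → Fires R ts ρg′ rs
    Fires-cong {rs = rs} agree (m , b) =
      subst (λ z → ⟦ z ⟧ᴸ rs) (sTs-cong ts (λ v _ → instSub-cong R agree v)) m ,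
      subst (λ z → I ⊨ τBody z) (map-sBE-cong (instSub-cong R agree) B) b

    global⊆fv : ∀ {g} → g ∈ globalVars R → pv g ∈ fvF F
    global⊆fv g∈ with ∈P.∈-++⁻ (varsH h) (∈-deduplicateᵇ⁻ (varsH h ++ concatMap globalBE B) g∈)
    ... | inj₁ g∈h = ∈-fvF-∧ˡ (conjL (mems V ts)) (φBody (localVars R) B)
                       (pv∈fvF-mems V ts ∣V∣ (subst (_ ∈_) h≡ts g∈h))
    ... | inj₂ g∈B = ∈-fvF-∧ʳ (conjL (mems V ts)) (φBody (localVars R) B)
                       (pv∈fvF-φBody (localVars R) B g∈B)

    basic⇔ : ∀ ρ₀ rs → length rs ≡ n →
             sat I (extend ρ₀ V rs) (exs (dropVs V (fvF F)) F) ⇔ Σ (ℕ → P) (λ ρg → Fires R ts ρg rs)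
    basic⇔ = ExistentialClosure.sat-∃U⇔ n F (globalVars R) global⊆fv (Fires R ts) Fires-cong F⇔Fires

    choice⇔ : ∀ p ρ₀ rs → length rs ≡ n → let F′ = F f∧ fAtom p (map aVar V) in
              sat I (extend ρ₀ V rs) (exs (dropVs V (fvF F′)) F′) ⇔
              Σ (ℕ → P) (λ ρg → Fires R ts ρg rs × I (p , rs))
    choice⇔ p = ExistentialClosure.sat-∃U⇔ n (F f∧ fAtom p (map aVar V)) (globalVars R)
      (∈-fvF-∧ˡ F (fAtom p (map aVar V)) ∘ global⊆fv) (λ ρg rs → Fires R ts ρg rs × I (p , rs))
      (λ agree (f , a) → Fires-cong agree f , a)
      (λ ρ → ⇔.trans (sat-∧ ρ F (fAtom p (map aVar V)))
                     (F⇔Fires ρ ×-⇔ ≡⇒⇔ (cong (λ z → I (p , z)) (evalAs-aVars ρ V))))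

  module _ (p : Sym) (n : ℕ) (ρ₀ : Env) (rs : List P) (∣rs∣ : length rs ≡ n) where

    Disjunct : Formula → Set
    Disjunct F = sat I (extend ρ₀ (newVs 0 n) rs) (exs (dropVs (newVs 0 n) (fvF F)) F)

    wrong-arity : ∀ {R ts ρg} → ¬ length ts ≡ n → ¬ ⟦ sTs (instSub R ρg) ts ⟧ᴸ rs
    wrong-arity {R} {ts} ∣ts∣≢n m = ∣ts∣≢n (trans (sym (⟦sTs⟧ᴸ-length (instSub R _) ts m)) ∣rs∣)

    disjuncts⇔supports : ∀ Γ → Any Disjunct (mapMaybe (defF p n) Γ) ⇔ Any (λ R → Supports R p rs) Γ
    disjuncts⇔supports [] = mk⇔ (λ ()) (λ ())
    disjuncts⇔supports ((basic (q , ts) ⟵ B) ∷ Γ) with lem {q ≡ p} | ℕ._≟_ (length ts) n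
    ... | yes refl | yes ∣ts∣ = Any-∷-⇔
            (⇔.trans (RuleDisjunct.basic⇔ (basic (q , ts)) ts refl B n ∣ts∣ ρ₀ rs ∣rs∣)
                     (mk⇔ (refl ,_) proj₂))
            (disjuncts⇔supports Γ)
    ... | yes _ | no ∣ts∣≢n = Any-skip (λ (_ , _ , m , _) → wrong-arity {basic (q , ts) ⟵ B} ∣ts∣≢n m)
            (disjuncts⇔supports Γ)
    ... | no q≢p | _ = Any-skip (q≢p ∘ proj₁) (disjuncts⇔supports Γ)
    disjuncts⇔supports ((choice (q , ts) ⟵ B) ∷ Γ) with lem {q ≡ p} | ℕ._≟_ (length ts) n
    ... | yes refl | yes ∣ts∣ = Any-∷-⇔
            (⇔.trans (RuleDisjunct.choice⇔ (choice (q , ts)) ts refl B n ∣ts∣ q ρ₀ rs ∣rs∣)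
                     (mk⇔ (refl ,_) proj₂))
            (disjuncts⇔supports Γ)
    ... | yes _ | no ∣ts∣≢n =
      Any-skip (λ (_ , _ , (m , _) , _) → wrong-arity {choice (q , ts) ⟵ B} ∣ts∣≢n m)
            (disjuncts⇔supports Γ)
    ... | no q≢p | _ = Any-skip (q≢p ∘ proj₁) (disjuncts⇔supports Γ)
    disjuncts⇔supports ((constraint ⟵ B) ∷ Γ) = Any-skip (λ ()) (disjuncts⇔supports Γ)

  ρ∞ : Env
  ρ∞ _ = pinf

  DefinitionHolds : Program → PredSym → Set
  DefinitionHolds Γ (p , n) = ∀ rs → length rs ≡ n → I (p , rs) ⇔ Any (λ R → Supports R p rs) Γ

  ConstraintHolds : Rule → Set
  ConstraintHolds R@(constraint ⟵ B) = ∀ ρg → ¬ I ⊨ τBody (map (sBE (instSub R ρg)) B)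
  ConstraintHolds _ = ⊤

  SupportedModel : Program → Set
  SupportedModel Γ = (∀ x → x ∈ preds Γ → DefinitionHolds Γ x) × All ConstraintHolds Γ

  sat-completedDef : ∀ Γ p n → sat I ρ∞ (completedDef Γ (p , n)) ⇔ DefinitionHolds Γ (p , n)
  sat-completedDef Γ p n = ⇔.trans (sat-alls ρ∞ V (A f⇔ D)) (mk⇔
      (λ h rs ∣rs∣ → let A⇒D , D⇒A = to (sat-∧ (ρ[ rs ]) (A f⇒ D) (D f⇒ A)) (h rs (∣V∣ rs ∣rs∣)) in
         mk⇔ (to (D⇔ rs ∣rs∣) ∘ A⇒D ∘ from (A⇔ rs ∣rs∣)) (to (A⇔ rs ∣rs∣) ∘ D⇒A ∘ from (D⇔ rs ∣rs∣)))
      (λ h rs e → let ∣rs∣ = trans e (length-newVs 0 n) in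
         from (sat-∧ (ρ[ rs ]) (A f⇒ D) (D f⇒ A))
           (from (D⇔ rs ∣rs∣) ∘ to (h rs ∣rs∣) ∘ to (A⇔ rs ∣rs∣) ,
            from (A⇔ rs ∣rs∣) ∘ from (h rs ∣rs∣) ∘ to (D⇔ rs ∣rs∣))))
    where
    V = newVs 0 n
    ρ[_] : List P → Env
    ρ[ rs ] = extend ρ∞ V rs
    closure : Formula → Formula
    closure F = exs (dropVs V (fvF F)) F
    A D : Formula
    A = fAtom p (map aVar V)
    D = disjL (map closure (mapMaybe (defF p n) Γ))
    ∣V∣ : ∀ rs → length rs ≡ n → length rs ≡ length V
    ∣V∣ rs ∣rs∣ = trans ∣rs∣ (sym (length-newVs 0 n))
    A⇔ : ∀ rs → length rs ≡ n → sat I ρ[ rs ] A ⇔ I (p , rs)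
    A⇔ rs = sat-atom-newVs ρ∞ p 0 n rs
    D⇔ : ∀ rs → length rs ≡ n → sat I ρ[ rs ] D ⇔ Any (λ R → Supports R p rs) Γ
    D⇔ rs ∣rs∣ = ⇔.trans (sat-disjL ρ[ rs ] (map closure (mapMaybe (defF p n) Γ)))
      (⇔.trans (mk⇔ AnyP.map⁻ AnyP.map⁺) (disjuncts⇔supports p n ρ∞ rs ∣rs∣ Γ))

  sat-constraint : ∀ B → let R = constraint ⟵ B ; F = f¬ (φBody (localVars R) B) in
                   sat I ρ∞ (alls (fvF F) F) ⇔ ConstraintHolds R
  sat-constraint B = mk⇔
    (λ h ρg τB → let w = globalEnv ρg ; ρ′ = extend ρ∞ U (map w U) in
      to (sat-alls ρ∞ U F) h (map w U) (LP.length-map w U)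
        (from (body⇔ ρ′) (subst (λ B′ → I ⊨ τBody B′)
           (map-sBE-cong (instSub-cong R (λ v v∈ → sym (extend-map-∈ ρ∞ w U (global⊆U v∈)))) B) τB)))
    (λ c → from (sat-alls ρ∞ U F) λ us _ φB → c _ (to (body⇔ (extend ρ∞ U us)) φB))
    where
    R = constraint ⟵ B
    F = f¬ (φBody (localVars R) B)
    U = fvF F
    body⇔ : ∀ ρ → sat I ρ (φBody (localVars R) B) ⇔ I ⊨ τBody (map (sBE (instSub R (ρ ∘ pv))) B)
    body⇔ ρ = φBody⇔τBody ρ _ (localVars R) B (scoped-instance constraint B ρ)
    global⊆U : ∀ {v} → v ∈ globalVars R → pv v ∈ U
    global⊆U v∈ = ∈P.∈-++⁺ˡ (pv∈fvF-φBody (localVars R) B (∈-deduplicateᵇ⁻ (concatMap globalBE B) v∈))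

  sat-constraints : ∀ Γ → All (sat I ρ∞) (mapMaybe constraintF Γ) ⇔ All ConstraintHolds Γ
  sat-constraints [] = mk⇔ (λ _ → []) (λ _ → [])
  sat-constraints ((basic _ ⟵ _) ∷ Γ) =
    mk⇔ (λ h → tt ∷ to (sat-constraints Γ) h) (from (sat-constraints Γ) ∘ All.tail)
  sat-constraints ((choice _ ⟵ _) ∷ Γ) =
    mk⇔ (λ h → tt ∷ to (sat-constraints Γ) h) (from (sat-constraints Γ) ∘ All.tail)
  sat-constraints ((constraint ⟵ B) ∷ Γ) =
    mk⇔ (λ { (c ∷ h) → to (sat-constraint B) c ∷ to (sat-constraints Γ) h })
        (λ { (c ∷ h) → from (sat-constraint B) c ∷ from (sat-constraints Γ) h })

  completion⇔supportedModel : ∀ Γ → SatCompletion Γ I ⇔ SupportedModel Γ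
  completion⇔supportedModel Γ = begin
    SatCompletion Γ I
      ∼⟨ mk⇔ (AllP.++⁻ (map (completedDef Γ) (preds Γ))) (λ (ds , cs) → AllP.++⁺ ds cs) ⟩
    (All (sat I ρ∞) (map (completedDef Γ) (preds Γ)) × All (sat I ρ∞) (mapMaybe constraintF Γ))
      ∼⟨ ⇔.trans (All-map (completedDef Γ) (preds Γ)) All⇔∀∈ ×-⇔ sat-constraints Γ ⟩
    ((∀ x → x ∈ preds Γ → sat I ρ∞ (completedDef Γ x)) × All ConstraintHolds Γ)
      ∼⟨ mk⇔ (λ d x x∈ → to (sat-completedDef Γ _ _) (d x x∈))
             (λ d x x∈ → from (sat-completedDef Γ _ _) (d x x∈)) ×-⇔ ⇔.refl ⟩
    SupportedModel Γ ∎
    where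
    All⇔∀∈ : ∀ {Q : PredSym → Set} {xs} → All Q xs ⇔ (∀ x → x ∈ xs → Q x)
    All⇔∀∈ = mk⇔ (λ qs _ → All.lookup qs) (λ h → All.tabulate (h _))

-- Reducts

module Reduct (S : Signature) (lem : ExcludedMiddle 0ℓ) where
  open Signature S
  open Lang S lem renaming (sym to symbol)
  open Syntax S lem

  reduct-⊨ : ∀ I F → I ⊨ F → reduct I F ≡ reduct′ I F
  reduct-⊨ I F I⊨F with lem {I ⊨ F}
  ... | yes _ = refl
  ... | no I⊭F = ⊥-elim (I⊭F I⊨F)

  reduct-sound : ∀ I J F → J ⊨ reduct I F → I ⊨ F
  reduct-sound I J F J⊨Fᴵ with lem {I ⊨ F}
  ... | yes I⊨F = I⊨F
  ... | no _ = ⊥-elim J⊨Fᴵ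

  ⊨-reduct : ∀ I F → I ⊨ F → I ⊨ reduct I F
  ⊨-reduct I F I⊨F rewrite reduct-⊨ I F I⊨F = go F I⊨F
    where
    go : ∀ F → I ⊨ F → I ⊨ reduct′ I F
    go (atm a) h = h
    go (⋀ K F) h k = ⊨-reduct I (F k) (h k)
    go (⋁ K F) (k , h) = k , ⊨-reduct I (F k) h
    go (G ⇒I H) h g = ⊨-reduct I H (h (reduct-sound I I G g))

  module ReductOf (I J : Interp) where

    reduct-atm⁺ : ∀ {a} → I a → J a → J ⊨ reduct I (atm a)
    reduct-atm⁺ {a} Ia Ja = subst (J ⊨_) (sym (reduct-⊨ I (atm a) Ia)) Ja

    reduct-atm⁻ : ∀ {a} → J ⊨ reduct I (atm a) → J a
    reduct-atm⁻ {a} h = subst (J ⊨_) (reduct-⊨ I (atm a) (reduct-sound I J (atm a) h)) h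

    reduct-⋀⁺ : ∀ {K F} → I ⊨ ⋀ K F → (∀ k → J ⊨ reduct I (F k)) → J ⊨ reduct I (⋀ K F)
    reduct-⋀⁺ I⊨F h = subst (J ⊨_) (sym (reduct-⊨ I _ I⊨F)) h

    reduct-⋀⁻ : ∀ {K F} → J ⊨ reduct I (⋀ K F) → ∀ k → J ⊨ reduct I (F k)
    reduct-⋀⁻ h = subst (J ⊨_) (reduct-⊨ I _ (reduct-sound I J _ h)) h

    reduct-⋁⁺ : ∀ {K F} k → I ⊨ ⋁ K F → J ⊨ reduct I (F k) → J ⊨ reduct I (⋁ K F)
    reduct-⋁⁺ k I⊨F h = subst (J ⊨_) (sym (reduct-⊨ I _ I⊨F)) (k , h)

    reduct-⋁⁻ : ∀ {K F} → J ⊨ reduct I (⋁ K F) → Σ K λ k → J ⊨ reduct I (F k)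
    reduct-⋁⁻ h = subst (J ⊨_) (reduct-⊨ I _ (reduct-sound I J _ h)) h

    reduct-⇒⁺ : ∀ {G H} → I ⊨ (G ⇒I H) → (J ⊨ reduct I G → J ⊨ reduct I H) → J ⊨ reduct I (G ⇒I H)
    reduct-⇒⁺ I⊨G⇒H h = subst (J ⊨_) (sym (reduct-⊨ I _ I⊨G⇒H)) h

    reduct-⇒⁻ : ∀ {G H} → J ⊨ reduct I (G ⇒I H) → J ⊨ reduct I G → J ⊨ reduct I H
    reduct-⇒⁻ h = subst (J ⊨_) (reduct-⊨ I _ (reduct-sound I J _ h)) h

  -- Antecedents are unconstrained: J ⊨ Gᴵ already forces I ⊨ G, and then (G ⇒ H)ᴵ only asks for Hᴵ.
  Positive : (Atom → Set) → IF → Set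
  Positive Q (atm a) = Q a
  Positive Q ⊥I = ⊤
  Positive Q (⋀ K F) = ∀ k → Positive Q (F k)
  Positive Q (⋁ K F) = ∀ k → Positive Q (F k)
  Positive Q (G ⇒I H) = Positive Q H

  ⊨-reduct-positive : ∀ I J Q → (∀ a → Q a → I a → J a) → ∀ F → Positive Q F → I ⊨ F → J ⊨ reduct I F
  ⊨-reduct-positive I J Q I⊆J F +F I⊨F rewrite reduct-⊨ I F I⊨F = go F +F I⊨F
    where
    go : ∀ F → Positive Q F → I ⊨ F → J ⊨ reduct′ I F
    go (atm a) q h = I⊆J a q h
    go (⋀ K F) +F h k = ⊨-reduct-positive I J Q I⊆J (F k) (+F k) (h k)
    go (⋁ K F) +F (k , h) = k , ⊨-reduct-positive I J Q I⊆J (F k) (+F k) h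
    go (G ⇒I H) +H h g = ⊨-reduct-positive I J Q I⊆J H +H (h (reduct-sound I J G g))

  Positive-mono : ∀ {Q Q′} → (∀ a → Q a → Q′ a) → ∀ F → Positive Q F → Positive Q′ F
  Positive-mono Q⊆Q′ (atm a) q = Q⊆Q′ a q
  Positive-mono Q⊆Q′ ⊥I _ = tt
  Positive-mono Q⊆Q′ (⋀ K F) +F k = Positive-mono Q⊆Q′ (F k) (+F k)
  Positive-mono Q⊆Q′ (⋁ K F) +F k = Positive-mono Q⊆Q′ (F k) (+F k)
  Positive-mono Q⊆Q′ (G ⇒I H) +H = Positive-mono Q⊆Q′ H +H

  Positive-⋀-lookup : ∀ Q {A : Set} (f : A → IF) xs → All (Positive Q ∘ f) xs →
                      Positive Q (⋀ (Fin (length xs)) (f ∘ lookup xs))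
  Positive-⋀-lookup Q f (x ∷ xs) (p ∷ _) Fin.zero = p
  Positive-⋀-lookup Q f (x ∷ xs) (_ ∷ ps) (Fin.suc i) = Positive-⋀-lookup Q f xs ps i

  predOf : Atom → PredSym
  predOf (p , rs) = p , length rs

  Positive-τC : ∀ σ c → Positive (λ a → predOf a ∈ predsCE c) (τC (sCE σ c))
  Positive-τC σ (lit (pos (p , ts))) (rs , m) = here (cong (p ,_) (⟦sTs⟧ᴸ-length σ ts m))
  Positive-τC σ (lit (neg (p , ts))) _ = tt
  Positive-τC σ (cmp r t u)
    with does (lem {Σ P λ r₁ → Σ P λ r₂ → ⟦ sT σ t ⟧ r₁ × ⟦ sT σ u ⟧ r₂ × relSem r r₁ r₂})
  ... | true = tt
  ... | false = tt

  Positive-τCs : ∀ σ C → Positive (λ a → predOf a ∈ concatMap predsCE C) (τCs (map (sCE σ) C))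
  Positive-τCs σ C = Positive-⋀-lookup _ τC (map (sCE σ) C) (AllP.map⁺ (All.tabulate λ {c} c∈ →
    Positive-mono (λ a → ∈-concatMap predsCE c∈) (τC (sCE σ c)) (Positive-τC σ c)))

  Positive-τB : ∀ σ b → Positive (λ a → predOf a ∈ posBE b) (τB (sBE σ b))
  Positive-τB σ (cel (lit (pos a))) = Positive-τC σ (lit (pos a))
  Positive-τB σ (cel (lit (neg a))) _ = tt
  Positive-τB σ (cel (cmp r t u)) =
    Positive-mono (λ _ ()) (τC (sCE σ (cmp r t u))) (Positive-τC σ (cmp r t u))
  Positive-τB σ (aggE α t C r s) _ _ =
    subst (λ C′ → Positive (λ a → predOf a ∈ concatMap predsCE C) (τCs C′))
          (sym (map-sCE-▹ σ _ C)) (Positive-τCs _ C)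

  Positive-τBody : ∀ σ B → Positive (λ a → predOf a ∈ concatMap posBE B) (τBody (map (sBE σ) B))
  Positive-τBody σ B = Positive-⋀-lookup _ τB (map (sBE σ) B) (AllP.map⁺ (All.tabulate λ {b} b∈ →
    Positive-mono (λ a → ∈-concatMap posBE b∈) (τB (sBE σ b)) (Positive-τB σ b)))

-- Stable and supported models

module Main (S : Signature) (lem : ExcludedMiddle 0ℓ) (Γ : Lang.Program S lem) (I : Lang.Interp S lem)
  where
  open Signature S
  open Lang S lem renaming (sym to symbol)
  open Syntax S lem
  open Correspondence S lem I
  open Reduct S lem

  from-τΓ : ∀ {J} → J ⊨ τΓ Γ → ∀ {R} → R ∈ Γ → ∀ ρg → J ⊨ τR (instance′ R ρg)
  from-τΓ {J} J⊨Γ R∈ ρg =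
    subst (λ R → J ⊨ τR (instance′ R ρg)) (sym (lookup-index R∈)) (J⊨Γ (Any.index R∈ , ρg))

  reduct-τΓ : ∀ {J} → I ⊨ τΓ Γ →
              J ⊨ reduct I (τΓ Γ) ⇔ (∀ {R} → R ∈ Γ → ∀ ρg → J ⊨ reduct I (τR (instance′ R ρg)))
  reduct-τΓ {J} I⊨Γ rewrite reduct-⊨ I (τΓ Γ) I⊨Γ = mk⇔
    (λ J⊨Γᴵ {R} R∈ ρg → subst (λ R → J ⊨ reduct I (τR (instance′ R ρg))) (sym (lookup-index R∈))
                              (J⊨Γᴵ (Any.index R∈ , ρg)))
    (λ J⊨Rᴵ (i , ρg) → J⊨Rᴵ (∈P.∈-lookup i) ρg)

  supportedModel⇒model : SupportedModel Γ → I ⊨ τΓ Γ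
  supportedModel⇒model (defs , constraints) (i , ρg) = rule (∈P.∈-lookup i) ρg
    where
    rule : ∀ {R} → R ∈ Γ → ∀ ρg → I ⊨ τR (instance′ R ρg)
    rule {R@(basic (q , ts) ⟵ B)} R∈ ρg body (rs , m) =
      from (defs _ (∈-concatMap predsR R∈ (here (cong (q ,_) ∣rs∣))) rs refl)
           (lose R∈ (refl , ρg , m , body))
      where ∣rs∣ = ⟦sTs⟧ᴸ-length (instSub R ρg) ts m
    rule {choice (q , ts) ⟵ B} R∈ ρg body (rs , m) with lem {I (q , rs)}
    ... | yes q∈I = true , q∈I
    ... | no q∉I = false , q∉I
    rule {constraint ⟵ B} R∈ ρg = All.lookup constraints R∈ ρg

  supports⇒I : I ⊨ τΓ Γ → ∀ {R p rs} → R ∈ Γ → Supports R p rs → I (p , rs)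
  supports⇒I I⊨Γ {basic (q , ts) ⟵ B} R∈ (refl , ρg , m , body) = from-τΓ I⊨Γ R∈ ρg body (_ , m)
  supports⇒I I⊨Γ {choice (q , ts) ⟵ B} R∈ (refl , _ , _ , q∈I) = q∈I
  supports⇒I I⊨Γ {constraint ⟵ B} R∈ ()

  module Unsupported (stable : StableIF (τΓ Γ) I) (p : Sym) (rs : List P)
                     (unsupported : ¬ Any (λ R → Supports R p rs) Γ) where
    I⊨Γ : I ⊨ τΓ Γ
    I⊨Γ = reduct-sound I I (τΓ Γ) (proj₁ stable)

    I⁻ : Interp
    I⁻ a = I a × a ≢ (p , rs)

    open ReductOf I I⁻

    I⁻⊨reduct : ∀ {R} → R ∈ Γ → ∀ ρg → I⁻ ⊨ reduct I (τR (instance′ R ρg))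
    I⁻⊨reduct {R} R∈ ρg = rule R refl (from-τΓ I⊨Γ R∈ ρg)
      where
      rule : ∀ R′ → R′ ≡ R → I ⊨ τR (instance′ R ρg) → I⁻ ⊨ reduct I (τR (instance′ R ρg))
      rule (basic (q , ts) ⟵ B) refl I⊨R = reduct-⇒⁺ I⊨R λ I⁻⊨Bᴵ →
        let I⊨B = reduct-sound I I⁻ _ I⁻⊨Bᴵ in
        reduct-⋀⁺ (I⊨R I⊨B) λ (rs′ , m) →
          reduct-atm⁺ (I⊨R I⊨B (rs′ , m))
            (I⊨R I⊨B (rs′ , m) , λ { refl → unsupported (lose R∈ (refl , ρg , m , I⊨B)) })
      rule (choice (q , ts) ⟵ B) refl I⊨R = reduct-⇒⁺ I⊨R λ I⁻⊨Bᴵ →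
        let I⊨B = reduct-sound I I⁻ _ I⁻⊨Bᴵ in
        reduct-⋀⁺ (I⊨R I⊨B) λ (rs′ , m) → choose rs′ m I⊨B (I⊨R I⊨B (rs′ , m))
        where
        choose : ∀ rs′ m I⊨B → I ⊨ ⋁ Bool (λ b → if b then atm (q , rs′) else ¬I (atm (q , rs′))) →
                 I⁻ ⊨ reduct I (⋁ Bool (λ b → if b then atm (q , rs′) else ¬I (atm (q , rs′))))
        choose rs′ m I⊨B I⊨q∨¬q with lem {I (q , rs′)}
        ... | yes q∈I = reduct-⋁⁺ true I⊨q∨¬q (reduct-atm⁺ q∈I
                          (q∈I , λ { refl → unsupported (lose R∈ (refl , ρg , (m , I⊨B) , q∈I)) }))
        ... | no q∉I = reduct-⋁⁺ false I⊨q∨¬q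
                         (reduct-⇒⁺ q∉I λ I⁻⊨q → ⊥-elim (q∉I (reduct-sound I I⁻ _ I⁻⊨q)))
      rule (constraint ⟵ B) refl I⊨R = reduct-⇒⁺ I⊨R λ I⁻⊨Bᴵ → ⊥-elim (I⊨R (reduct-sound I I⁻ _ I⁻⊨Bᴵ))

    not-in-I : ¬ I (p , rs)
    not-in-I p∈I = proj₂ stable I⁻ (λ _ → proj₁) (λ I⊆I⁻ → proj₂ (I⊆I⁻ (p , rs) p∈I) refl)
                     (from (reduct-τΓ I⊨Γ) I⁻⊨reduct)

  stable⇒supportedModel : StableIF (τΓ Γ) I → SupportedModel Γ
  stable⇒supportedModel stable =
    (λ { (p , n) _ rs refl →
           mk⇔ (λ p∈I → dne λ unsupported → Unsupported.not-in-I stable p rs unsupported p∈I)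
               (λ supported → let _ , R∈ , s = find supported in supports⇒I I⊨Γ R∈ s) }) ,
    All.tabulate (λ {R} R∈ → constraint-holds R R∈)
    where
    I⊨Γ = reduct-sound I I (τΓ Γ) (proj₁ stable)
    constraint-holds : ∀ R → R ∈ Γ → ConstraintHolds R
    constraint-holds (basic _ ⟵ _) _ = tt
    constraint-holds (choice _ ⟵ _) _ = tt
    constraint-holds (constraint ⟵ B) R∈ = from-τΓ I⊨Γ R∈

  edge : ∀ {R x y} → R ∈ Γ → x ∈ predsH (head R) → y ∈ concatMap posBE (body R) → Edge Γ x y
  edge {x = x} {y} R∈ x∈ y∈ = Any.index R∈ ,
    subst (λ R → x ∈ predsH (head R) × y ∈ concatMap posBE (body R)) (lookup-index R∈) (x∈ , y∈)

  source∈preds : ∀ {x y} → Edge Γ x y → x ∈ preds Γ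
  source∈preds (i , x∈ , _) = ∈-concatMap predsR (∈P.∈-lookup {xs = Γ} i) (∈P.∈-++⁺ˡ x∈)

  module Derivation (I⊨Γ : I ⊨ τΓ Γ) (J : Interp) (J⊨Γᴵ : J ⊨ reduct I (τΓ Γ)) where
    open ReductOf I J

    J⊨body : ∀ {R x} ρg → R ∈ Γ → x ∈ predsH (head R) → (∀ a → Edge Γ x (predOf a) → I a → J a) →
             let Body = τBody (map (sBE (instSub R ρg)) (body R)) in I ⊨ Body → J ⊨ reduct I Body
    J⊨body {R} ρg R∈ x∈ below =
      ⊨-reduct-positive I J _ (λ a a∈ → below a (edge R∈ x∈ a∈)) _
                        (Positive-τBody (instSub R ρg) (body R))

    derive : ∀ {R p rs} → R ∈ Γ → Supports R p rs →
             (∀ a → Edge Γ (p , length rs) (predOf a) → I a → J a) → J (p , rs)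
    derive {R@(basic (p , ts) ⟵ B)} {rs = rs} R∈ (refl , ρg , m , I⊨B) below =
      reduct-atm⁻ (reduct-⋀⁻ (reduct-⇒⁻ (to (reduct-τΓ I⊨Γ) J⊨Γᴵ R∈ ρg) J⊨Bᴵ) (rs , m))
      where J⊨Bᴵ = J⊨body ρg R∈ (here (cong (p ,_) (⟦sTs⟧ᴸ-length _ ts m))) below I⊨B
    derive {R@(choice (p , ts) ⟵ B)} {rs = rs} R∈ (refl , ρg , (m , I⊨B) , p∈I) below =
      chosen (reduct-⋁⁻ (reduct-⋀⁻ (reduct-⇒⁻ (to (reduct-τΓ I⊨Γ) J⊨Γᴵ R∈ ρg) J⊨Bᴵ) (rs , m)))
      where
      J⊨Bᴵ = J⊨body ρg R∈ (here (cong (p ,_) (⟦sTs⟧ᴸ-length _ ts m))) below I⊨B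
      chosen : Σ Bool (λ b → J ⊨ reduct I (if b then atm (p , rs) else ¬I (atm (p , rs)))) → J (p , rs)
      chosen (true , J⊨p) = reduct-atm⁻ J⊨p
      chosen (false , J⊨¬p) = ⊥-elim (reduct-sound I J _ J⊨¬p p∈I)

    I⊆J : SupportedModel Γ → InVocab Γ I → WellFounded (flip (Edge Γ)) → I ⊆ J
    I⊆J (defs , _) vocab wf (p , rs) = go (wf _) p rs refl
      where
      go : ∀ {v} → Acc (flip (Edge Γ)) v → ∀ p rs → predOf (p , rs) ≡ v → I (p , rs) → J (p , rs)
      go (acc below) p rs refl p∈I =
        let _ , R∈ , support = find (to (defs _ (vocab p rs p∈I) rs refl) p∈I)
        in derive R∈ support (λ (q , rs′) e → go (below e) q rs′ refl)

  supportedModel⇒stable : Tight Γ → InVocab Γ I → SupportedModel Γ → StableIF (τΓ Γ) I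
  supportedModel⇒stable tight vocab model = ⊨-reduct I (τΓ Γ) I⊨Γ , λ J _ I⊈J J⊨Γᴵ →
    I⊈J (Derivation.I⊆J I⊨Γ J J⊨Γᴵ model vocab (acyclic⇒wellFounded (preds Γ) source∈preds tight))
    where I⊨Γ = supportedModel⇒model model

theorem2 : (S : Signature) (lem : ExcludedMiddle 0ℓ) (Γ : Lang.Program S lem) →
           Lang.Tight S lem Γ → (I : Lang.Interp S lem) →
           Lang.StableModel S lem Γ I ⇔
             (Lang.InVocab S lem Γ I × Lang.SatCompletion S lem Γ I)
theorem2 S lem Γ tight I = mk⇔
  (λ (vocab , stable) → vocab , from completion⇔ (stable⇒supportedModel stable))
  (λ (vocab , completion) → vocab , supportedModel⇒stable tight vocab (to completion⇔ completion))
  where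
  open Correspondence S lem I using (completion⇔supportedModel)
  open Main S lem Γ I using (stable⇒supportedModel; supportedModel⇒stable)
  completion⇔ = completion⇔supportedModel Γ
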